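{- Consider strings $X,Y\in \Sigma^{*}$, an integer $k\ge 0$, and a pair $(x,y)\in [0\,.\,.\,|X|]\times [0\,.\,.\,|Y|]$. Let $i$ be the minimum $i\in [0\,.\,.\,x]$ such that $|\mathsf{LZ}(\overline{X(i\,.\,.\,x]})|\le 6k+2$, let $j$ be the maximum $j\in [x\,.\,.\,|X|]$ such that $|\mathsf{LZ}(X(x\,.\,.\,j])|\le 6k+2$, and let $X'=X(i\,.\,.\,j]$ and $Y'=Y(i\,.\,.\,j+|Y|-|X|]$. If $\mathsf{ed}(X,Y)\le k$, then $(x,y)$ is an edit anchor of $X$ and $Y$ if and only if it is an edit anchor of the fragments $X'$ and $Y'$.
   Context: $X(i\,.\,.\,j]$ denotes $X[i+1]\cdots X[j]$ and $\overline{S}$ denotes the reverse of a string $S$. $\mathsf{ed}$ is edit distance (minimum number of insertions, deletions, substitutions). $\mathsf{LZ}(S)$ is the LZ77 factorization of $S$ (greedy left-to-right parsing into phrases, each the longest fragment starting at the current position that also occurs starting at an earlier position, or a single character if none exists) and $|\mathsf{LZ}(S)|$ its number of phrases. A pair $(x,y)\in[a\,.\,.\,b]\times[a'\,.\,.\,b']$ is an edit anchor of fragments $X(a\,.\,.\,b]$ and $Y(a'\,.\,.\,b']$ if $\mathsf{ed}(X(a\,.\,.\,b],Y(a'\,.\,.\,b'])=\mathsf{ed}(X(a\,.\,.\,x],Y(a'\,.\,.\,y])+\mathsf{ed}(X(x\,.\,.\,b],Y(y\,.\,.\,b'])$; an edit anchor of $X$ and $Y$ means one of $X(0\,.\,.\,|X|]$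 and $Y(0\,.\,.\,|Y|]$. -}

module Defs where

open import Data.Nat using (ℕ; zero; suc; _+_; _∸_; _≤_; _<_; _⊔_; _⊓_)
open import Data.Nat.Properties using (_≤?_)
open import Data.List using (List; []; _∷_; length; take; drop; reverse; upTo; map; foldr)
open import Data.Product using (_×_)
open import Relation.Binary.Definitions using (DecidableEquality)
open import Relation.Binary.PropositionalEquality using (_≡_)
open import Relation.Nullary using (yes; no)

module _ {A : Set} (_≟_ : DecidableEquality A) where

  subCost : A → A → ℕ
  subCost a b with a ≟ b
  ... | yes _ = 0
  ... | no _  = 1

  ed : List A → List A → ℕ
  ed [] ys = length ys
  ed (x ∷ xs) [] = suc (length xs)
  ed (x ∷ xs) (y ∷ ys) =
    (subCost x y + ed xs ys) ⊓ (suc (ed xs (y ∷ ys)) ⊓ suc (ed (x ∷ xs) ys))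

  lcp : List A → List A → ℕ
  lcp (a ∷ as) (b ∷ bs) with a ≟ b
  ... | yes _ = suc (lcp as bs)
  ... | no _  = 0
  lcp _ _ = 0

  -- length of the longest fragment starting at position p of S that also
  -- occurs (possibly overlapping) in S starting at some earlier position q < p
  lpf : List A → ℕ → ℕ
  lpf S p = foldr (λ q m → lcp (drop q S) (drop p S) ⊔ m) 0 (upTo p)

  -- LZ77 phrases, as (start, length) pairs; the fuel argument is |S|,
  -- which suffices since every phrase has length ≥ 1.
  lzFrom : ℕ → List A → ℕ → List (ℕ × ℕ)
  lzFrom zero S p = []
  lzFrom (suc f) S p with length S ≤? p
  ... | yes _ = []
  ... | no _  = (p Data.Product., (1 ⊔ lpf S p)) ∷ lzFrom f S (p + (1 ⊔ lpf S p))

  LZ : List A → List (ℕ × ℕ)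
  LZ S = lzFrom (length S) S 0

  lzSize : List A → ℕ
  lzSize S = length (LZ S)

  -- X(a .. b] = X[a+1] ... X[b]  (0-indexed: positions a .. b-1)
  frag : List A → ℕ → ℕ → List A
  frag X a b = take (b ∸ a) (drop a X)

  EditAnchorFrag : List A → List A → ℕ → ℕ → ℕ → ℕ → ℕ → ℕ → Set
  EditAnchorFrag X Y a b a' b' x y =
    (a ≤ x) × (x ≤ b) × (a' ≤ y) × (y ≤ b') ×
    (ed (frag X a b) (frag Y a' b') ≡ ed (frag X a x) (frag Y a' y) + ed (frag X x b) (frag Y y b'))

  EditAnchor : List A → List A → ℕ → ℕ → Set
  EditAnchor X Y x y = EditAnchorFrag X Y 0 (length X) 0 (length Y) x y

{-# OPTIONS --safe #-}
module Submission where

-- Two alignments of total cost O(k) that do not meet over a fragment of X make it compressible: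
-- wherever both match letters of X with the same letter of Y, one of these letters repeats the
-- other, so the fragment has an LZ77-style factorisation with O(k) phrases. By the choice of i
-- and j, an optimal alignment through (x , y) and an optimal alignment of X′ and Y′ therefore
-- meet both in X(i .. x] and in X(x .. j]; between the two meeting points either alignment can be
-- replaced by the other without losing optimality, which transfers the anchor (x , y) in both
-- directions.

open import Defs
open import Data.Empty using (⊥-elim)
open import Data.List using (List; []; _∷_; length; take; drop; reverse; foldr; applyUpTo; upTo; _∷ʳ_)
open import Data.List.Properties using (length-drop; length-take; length-reverse; unfold-reverse; take-all)
open import Data.Maybe using (Maybe; just; nothing)
open import Data.Nat using (ℕ; zero; suc; _+_; _*_; _∸_; _≤_; _<_; _⊔_; _⊓_; z≤n; s≤s; ∣_-_∣) renaming (_≟_ to _≟ℕ_)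
open import Data.Nat.Properties hiding (_≟_)
open import Data.Nat.Tactic.RingSolver using (solve-∀)
open import Data.Product using (Σ; _×_; _,_; proj₁; proj₂)
open import Data.Sum using (_⊎_; inj₁; inj₂)
open import Function using (_∘_; id)
open import Function.Bundles using (_⇔_; mk⇔)
open import Relation.Nullary using (yes; no)
open import Relation.Binary.Definitions using (DecidableEquality; tri<; tri≈; tri>)
open import Relation.Binary.PropositionalEquality

∸-suc : ∀ {a c} → a < c → c ∸ a ≡ suc (c ∸ suc a)
∸-suc = +-∸-assoc 1

∣m-n∣≤o : ∀ {m n o} → m ≤ n + o → n ≤ m + o → ∣ m - n ∣ ≤ o
∣m-n∣≤o {m} {n} h₁ h₂ with ∣m-n∣≡[m∸n]∨[n∸m] m n
... | inj₁ e rewrite e = m≤n+o⇒m∸n≤o m n h₁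
... | inj₂ e rewrite e = m≤n+o⇒m∸n≤o n m h₂

≤-by : ∀ {a b} k → b ≡ a + k → a ≤ b
≤-by {a} k refl = m≤m+n a k

foldr-⊔-≥ : ∀ (h g : ℕ → ℕ) n {q} → q < n → h (g q) ≤ foldr (λ i m → h i ⊔ m) 0 (applyUpTo g n)
foldr-⊔-≥ h g (suc n) {zero}  _         = m≤m⊔n _ _
foldr-⊔-≥ h g (suc n) {suc q} (s≤s q<n) = ≤-trans (foldr-⊔-≥ h (g ∘ suc) n q<n) (m≤n⊔m _ _)

foldr-⊔-≤ : ∀ (h : ℕ → ℕ) {B} is → (∀ i → h i ≤ B) → foldr (λ i m → h i ⊔ m) 0 is ≤ B
foldr-⊔-≤ h []       _   = z≤n
foldr-⊔-≤ h (i ∷ is) h≤B = ⊔-lub (h≤B i) (foldr-⊔-≤ h is h≤B)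

module Lipschitz (f : ℕ → ℕ) {lo hi : ℕ}
                 (step : ∀ {z} → lo ≤ z → suc z ≤ hi → f (suc z) ≤ suc (f z) × f z ≤ suc (f (suc z))) where

  lipschitz-+ : ∀ k {z} → lo ≤ z → z + k ≤ hi → f (z + k) ≤ f z + k × f z ≤ f (z + k) + k
  lipschitz-+ zero {z} _ _ rewrite +-identityʳ z | +-identityʳ (f z) = ≤-refl , ≤-refl
  lipschitz-+ (suc k) {z} lo≤z z+k<hi rewrite +-suc z k | +-suc (f z) k
    with lipschitz-+ k lo≤z (<⇒≤ z+k<hi) | step (≤-trans lo≤z (m≤m+n z k)) z+k<hi
  ... | up , down | up₁ , down₁ =
    ≤-trans up₁ (s≤s up) ,
    ≤-trans down (≤-trans (+-monoˡ-≤ k down₁) (≤-reflexive (sym (+-suc _ k))))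

  lipschitz : ∀ {z z′} → lo ≤ z → z ≤ hi → lo ≤ z′ → z′ ≤ hi → f z′ ≤ f z + ∣ z - z′ ∣
  lipschitz {z} {z′} lo≤z _ lo≤z′ z′≤hi with ≤-total z z′
  ... | inj₁ z≤z′ = subst₂ (λ u v → f u ≤ f z + v) (m+[n∸m]≡n z≤z′) (sym (m≤n⇒∣m-n∣≡n∸m z≤z′))
                      (proj₁ (lipschitz-+ (z′ ∸ z) lo≤z (subst (_≤ hi) (sym (m+[n∸m]≡n z≤z′)) z′≤hi)))
  lipschitz {z} {z′} lo≤z z≤hi lo≤z′ _ | inj₂ z′≤z =
    subst₂ (λ u v → f z′ ≤ f u + v) (m+[n∸m]≡n z′≤z) (sym (m≤n⇒∣n-m∣≡n∸m z′≤z))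
      (proj₂ (lipschitz-+ (z ∸ z′) lo≤z′ (subst (_≤ hi) (sym (m+[n∸m]≡n z′≤z)) z≤hi)))

∣m-[m+n∸o]∣≤∣o-n∣ : ∀ m n o → ∣ m - (m + n ∸ o) ∣ ≤ ∣ o - n ∣
∣m-[m+n∸o]∣≤∣o-n∣ m n o = ∣m-n∣≤o (+-cancelʳ-≤ n m _ (begin
    m + n                        ≤⟨ m≤n+m∸n (m + n) o ⟩
    o + (m + n ∸ o)              ≤⟨ +-monoˡ-≤ (m + n ∸ o) (m≤n+∣m-n∣ o n) ⟩
    n + ∣ o - n ∣ + (m + n ∸ o)   ≡⟨ swap₁₃ n ∣ o - n ∣ (m + n ∸ o) ⟩
    m + n ∸ o + ∣ o - n ∣ + n     ∎))
  (m≤n+o⇒m∸n≤o (m + n) o (begin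
    m + n                        ≤⟨ +-monoʳ-≤ m (m≤n+∣n-m∣ n o) ⟩
    m + (o + ∣ o - n ∣)           ≡⟨ swap₁₂ m o ∣ o - n ∣ ⟩
    o + (m + ∣ o - n ∣)           ∎))
  where
    open ≤-Reasoning
    swap₁₃ : ∀ a b c → a + b + c ≡ c + b + a
    swap₁₃ = solve-∀
    swap₁₂ : ∀ a b c → a + (b + c) ≡ b + (a + c)
    swap₁₂ = solve-∀

[m∸n]∸[m∸o]≡o∸n : ∀ {m n o} → n ≤ o → o ≤ m → (m ∸ n) ∸ (m ∸ o) ≡ o ∸ n
[m∸n]∸[m∸o]≡o∸n {m} {n} {o} n≤o o≤m = begin
  (m ∸ n) ∸ (m ∸ o)              ≡⟨ ∸-+-assoc m n (m ∸ o) ⟩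
  m ∸ (n + (m ∸ o))              ≡⟨ cong₂ _∸_ (sym (m∸n+n≡m o≤m)) (+-comm n (m ∸ o)) ⟩
  ((m ∸ o) + o) ∸ ((m ∸ o) + n)  ≡⟨ [m+n]∸[m+o]≡n∸o (m ∸ o) o n ⟩
  o ∸ n                          ∎
  where open ≡-Reasoning

∣m∸o-n∸o∣≡∣m-n∣ : ∀ {m n o} → o ≤ m → o ≤ n → ∣ (m ∸ o) - (n ∸ o) ∣ ≡ ∣ m - n ∣
∣m∸o-n∸o∣≡∣m-n∣ {m} {n} {o} o≤m o≤n =
  trans (sym (∣m+n-m+o∣≡∣n-o∣ o (m ∸ o) (n ∸ o))) (cong₂ ∣_-_∣ (m+[n∸m]≡n o≤m) (m+[n∸m]≡n o≤n))

∣m∸n-m∸o∣≡∣n-o∣ : ∀ {m n o} → n ≤ m → o ≤ m → ∣ (m ∸ n) - (m ∸ o) ∣ ≡ ∣ n - o ∣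
∣m∸n-m∸o∣≡∣n-o∣ {m} {n} {o} n≤m o≤m with ≤-total n o
... | inj₁ n≤o = trans (m≤n⇒∣n-m∣≡n∸m (∸-monoʳ-≤ m n≤o))
                       (trans ([m∸n]∸[m∸o]≡o∸n n≤o o≤m) (sym (m≤n⇒∣m-n∣≡n∸m n≤o)))
... | inj₂ o≤n = trans (m≤n⇒∣m-n∣≡n∸m (∸-monoʳ-≤ m o≤n))
                       (trans ([m∸n]∸[m∸o]≡o∸n o≤n n≤m) (sym (m≤n⇒∣n-m∣≡n∸m o≤n)))

budget≤6k+2 : ∀ {k u v p q δ} → u + p ≤ k → v + q ≤ k → δ ≤ (u + p) + (v + q) → 2 + 2 * (u + v) + δ ≤ 6 * k + 2
budget≤6k+2 {k} {u} {v} {p} {q} {δ} h₁ h₂ h₃ = begin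
  2 + 2 * (u + v) + δ   ≤⟨ +-mono-≤ (+-monoʳ-≤ 2 (*-monoʳ-≤ 2 (+-mono-≤ (m≤m+n u p) (m≤m+n v q)))) h₃ ⟩
  2 + 2 * w + w         ≡⟨ triple w ⟩
  3 * w + 2             ≤⟨ +-monoˡ-≤ 2 (*-monoʳ-≤ 3 (+-mono-≤ h₁ h₂)) ⟩
  3 * (k + k) + 2       ≡⟨ cong (_+ 2) (sextuple k) ⟩
  6 * k + 2             ∎
  where
    open ≤-Reasoning
    w = (u + p) + (v + q)
    triple : ∀ w → 2 + 2 * w + w ≡ 3 * w + 2
    triple = solve-∀
    sextuple : ∀ k → 3 * (k + k) ≡ 6 * k
    sextuple = solve-∀

module EditAnchors {A : Set} (_≟_ : DecidableEquality A) where

  _!?_ : List A → ℕ → Maybe A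
  []       !? _     = nothing
  (u ∷ us) !? zero  = just u
  (u ∷ us) !? suc i = us !? i

  matchCost : Maybe A → Maybe A → ℕ
  matchCost (just u) (just v) = subCost _≟_ u v
  matchCost _        _        = 1

  matchCost≡0 : ∀ p q → matchCost p q ≡ 0 → Σ A λ u → p ≡ just u × q ≡ just u
  matchCost≡0 (just u) (just v) e with u ≟ v
  matchCost≡0 (just u) (just v) e  | yes refl = u , refl , refl
  matchCost≡0 (just u) (just v) () | no _
  matchCost≡0 (just u) nothing  ()
  matchCost≡0 nothing  q        ()

  frag-empty : ∀ X {a c} → c ≤ a → frag _≟_ X a c ≡ []
  frag-empty X c≤a rewrite m≤n⇒m∸n≡0 c≤a = refl

  drop-uncons : ∀ X a → a < length X → Σ A λ u → X !? a ≡ just u × drop a X ≡ u ∷ drop (suc a) X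
  drop-uncons (u ∷ X) zero    _         = u , refl , refl
  drop-uncons (u ∷ X) (suc a) (s≤s a<n) = drop-uncons X a a<n

  frag-uncons : ∀ X {a c} → a < c → c ≤ length X →
                Σ A λ u → X !? a ≡ just u × frag _≟_ X a c ≡ u ∷ frag _≟_ X (suc a) c
  frag-uncons X {a} {c} a<c c≤n with drop-uncons X a (<-≤-trans a<c c≤n)
  ... | u , Xa≡u , drop≡ rewrite ∸-suc a<c | drop≡ = u , Xa≡u , refl

  length-frag : ∀ X {a c} → a ≤ c → c ≤ length X → length (frag _≟_ X a c) ≡ c ∸ a
  length-frag X {a} {c} a≤c c≤n = begin
    length (take (c ∸ a) (drop a X))  ≡⟨ length-take (c ∸ a) (drop a X) ⟩
    (c ∸ a) ⊓ length (drop a X)       ≡⟨ cong ((c ∸ a) ⊓_) (length-drop a X) ⟩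
    (c ∸ a) ⊓ (length X ∸ a)          ≡⟨ m≤n⇒m⊓n≡m (∸-monoˡ-≤ a c≤n) ⟩
    c ∸ a                             ∎
    where open ≡-Reasoning

  -- Alignments of X(a..c] with Y(b..d], as monotone paths in the grid from (a , b) to (c , d):
  -- diag aligns X[a] with Y[b], del deletes X[a], ins inserts Y[b].
  module Alignment (fX fY : ℕ → Maybe A) where

    data Path : ℕ → ℕ → ℕ → ℕ → Set where
      []   : ∀ {a b} → Path a b a b
      diag : ∀ {a b c d} → Path (suc a) (suc b) c d → Path a b c d
      del  : ∀ {a b c d} → Path (suc a) b c d → Path a b c d
      ins  : ∀ {a b c d} → Path a (suc b) c d → Path a b c d

    cost : ∀ {a b c d} → Path a b c d → ℕ
    cost []               = 0
    cost (diag {a} {b} p) = matchCost (fX a) (fY b) + cost p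
    cost (del p)          = suc (cost p)
    cost (ins p)          = suc (cost p)

    _++ₚ_ : ∀ {a b c d e f} → Path a b c d → Path c d e f → Path a b e f
    []     ++ₚ q = q
    diag p ++ₚ q = diag (p ++ₚ q)
    del p  ++ₚ q = del (p ++ₚ q)
    ins p  ++ₚ q = ins (p ++ₚ q)

    cost-++ : ∀ {a b c d e f} (p : Path a b c d) (q : Path c d e f) → cost (p ++ₚ q) ≡ cost p + cost q
    cost-++ []               q = refl
    cost-++ (diag {a} {b} p) q = trans (cong (matchCost (fX a) (fY b) +_) (cost-++ p q))
                                       (sym (+-assoc (matchCost (fX a) (fY b)) (cost p) (cost q)))
    cost-++ (del p)          q = cong suc (cost-++ p q)
    cost-++ (ins p)          q = cong suc (cost-++ p q)

    start≤end : ∀ {a b c d} → Path a b c d → a ≤ c × b ≤ d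
    start≤end []       = ≤-refl , ≤-refl
    start≤end (diag p) = let a<c , b<d = start≤end p in <⇒≤ a<c , <⇒≤ b<d
    start≤end (del p)  = let a<c , b≤d = start≤end p in <⇒≤ a<c , b≤d
    start≤end (ins p)  = let a≤c , b<d = start≤end p in a≤c , <⇒≤ b<d

    rows≤cols+cost : ∀ {a b c d} (p : Path a b c d) → c ∸ a ≤ (d ∸ b) + cost p
    rows≤cols+cost {a} [] rewrite n∸n≡0 a = z≤n
    rows≤cols+cost {a} {b} {c} {d} (diag {a} {b} p) with start≤end p
    ... | a<c , b<d rewrite ∸-suc a<c | ∸-suc b<d =
      s≤s (≤-trans (rows≤cols+cost p) (+-monoʳ-≤ (d ∸ suc b) (m≤n+m (cost p) (matchCost (fX a) (fY b)))))
    rows≤cols+cost {a} {b} {c} {d} (del p) with start≤end p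
    ... | a<c , _ rewrite ∸-suc a<c | +-suc (d ∸ b) (cost p) = s≤s (rows≤cols+cost p)
    rows≤cols+cost {a} {b} {c} {d} (ins p) with start≤end p
    ... | _ , b<d rewrite ∸-suc b<d = ≤-trans (rows≤cols+cost p) (+-mono-≤ (n≤1+n _) (n≤1+n _))

    cols≤rows+cost : ∀ {a b c d} (p : Path a b c d) → d ∸ b ≤ (c ∸ a) + cost p
    cols≤rows+cost {a} {b} [] rewrite n∸n≡0 b = z≤n
    cols≤rows+cost {a} {b} {c} {d} (diag {a} {b} p) with start≤end p
    ... | a<c , b<d rewrite ∸-suc a<c | ∸-suc b<d =
      s≤s (≤-trans (cols≤rows+cost p) (+-monoʳ-≤ (c ∸ suc a) (m≤n+m (cost p) (matchCost (fX a) (fY b)))))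
    cols≤rows+cost {a} {b} {c} {d} (ins p) with start≤end p
    ... | _ , b<d rewrite ∸-suc b<d | +-suc (c ∸ a) (cost p) = s≤s (cols≤rows+cost p)
    cols≤rows+cost {a} {b} {c} {d} (del p) with start≤end p
    ... | a<c , _ rewrite ∸-suc a<c = ≤-trans (cols≤rows+cost p) (+-mono-≤ (n≤1+n _) (n≤1+n _))

    rows≤cost : ∀ {a b c} (p : Path a b c b) → c ∸ a ≤ cost p
    rows≤cost {a} {b} {c} p = subst (λ z → c ∸ a ≤ z + cost p) (n∸n≡0 b) (rows≤cols+cost p)

    ∣rows-cols∣≤cost : ∀ {a b c d} (p : Path a b c d) → ∣ (c ∸ a) - (d ∸ b) ∣ ≤ cost p
    ∣rows-cols∣≤cost p = ∣m-n∣≤o (rows≤cols+cost p) (cols≤rows+cost p)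

    Through : ∀ {a b c d} → Path a b c d → ℕ → ℕ → Set
    Through {a} {b} {c} {d} p r s =
      Σ (Path a b r s) λ p₁ → Σ (Path r s c d) λ p₂ → cost p₁ + cost p₂ ≡ cost p

    Meet : ∀ {a b c d a′ b′ c′ d′} → Path a b c d → Path a′ b′ c′ d′ → Set
    Meet p q = Σ ℕ λ r → Σ ℕ λ s → Through p r s × Through q r s

    through-start : ∀ {a b c d} (p : Path a b c d) → Through p a b
    through-start p = [] , p , refl

    through-end : ∀ {a b c d} (p : Path a b c d) → Through p c d
    through-end p = p , [] , +-identityʳ (cost p)

    through-diag : ∀ {a b c d r s} {p : Path (suc a) (suc b) c d} → Through p r s → Through (diag p) r s
    through-diag {a} {b} (p₁ , p₂ , e) =
      diag p₁ , p₂ , trans (+-assoc (matchCost (fX a) (fY b)) (cost p₁) (cost p₂))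
                           (cong (matchCost (fX a) (fY b) +_) e)

    through-del : ∀ {a b c d r s} {p : Path (suc a) b c d} → Through p r s → Through (del p) r s
    through-del (p₁ , p₂ , e) = del p₁ , p₂ , cong suc e

    through-ins : ∀ {a b c d r s} {p : Path a (suc b) c d} → Through p r s → Through (ins p) r s
    through-ins (p₁ , p₂ , e) = ins p₁ , p₂ , cong suc e

    through-row : ∀ {a b c d r} (p : Path a b c d) → a ≤ r → r ≤ c → Σ ℕ (Through p r)
    through-row {a} {b} {r = r} p a≤r r≤c with a ≟ℕ r
    ... | yes refl = b , through-start p
    through-row []       a≤r r≤c | no a≢r = ⊥-elim (a≢r (≤-antisym a≤r r≤c))
    through-row (diag p) a≤r r≤c | no a≢r =
      let s , t = through-row p (≤∧≢⇒< a≤r a≢r) r≤c in s , through-diag {p = p} t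
    through-row (del p)  a≤r r≤c | no a≢r =
      let s , t = through-row p (≤∧≢⇒< a≤r a≢r) r≤c in s , through-del {p = p} t
    through-row (ins p)  a≤r r≤c | no a≢r =
      let s , t = through-row p a≤r r≤c in s , through-ins {p = p} t

    through-second : ∀ {a b c d r₁ s₁ r s} {p : Path a b c d} ((_ , p₂ , _) : Through p r₁ s₁) →
                     Through p₂ r s → Through p r s
    through-second (p₁ , p₂ , e) (q₁ , q₂ , e′) = p₁ ++ₚ q₁ , q₂ , (begin
      cost (p₁ ++ₚ q₁) + cost q₂    ≡⟨ cong (_+ cost q₂) (cost-++ p₁ q₁) ⟩
      cost p₁ + cost q₁ + cost q₂   ≡⟨ +-assoc (cost p₁) (cost q₁) (cost q₂) ⟩
      cost p₁ + (cost q₁ + cost q₂) ≡⟨ cong (cost p₁ +_) e′ ⟩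
      cost p₁ + cost p₂             ≡⟨ e ⟩
      _                             ∎)
      where open ≡-Reasoning

    through-first : ∀ {a b c d r₁ s₁ r s} {p : Path a b c d} ((p₁ , _ , _) : Through p r₁ s₁) →
                    Through p₁ r s → Through p r s
    through-first (p₁ , p₂ , e) (q₁ , q₂ , e′) = q₁ , q₂ ++ₚ p₂ , (begin
      cost q₁ + cost (q₂ ++ₚ p₂)    ≡⟨ cong (cost q₁ +_) (cost-++ q₂ p₂) ⟩
      cost q₁ + (cost q₂ + cost p₂) ≡⟨ +-assoc (cost q₁) (cost q₂) (cost p₂) ⟨
      cost q₁ + cost q₂ + cost p₂   ≡⟨ cong (_+ cost p₂) e′ ⟩
      cost p₁ + cost p₂             ≡⟨ e ⟩
      _                             ∎)
      where open ≡-Reasoning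

  ed-[]ʳ : ∀ us → ed _≟_ us [] ≡ length us
  ed-[]ʳ []      = refl
  ed-[]ʳ (_ ∷ _) = refl

  ed-diag : ∀ u v us vs → ed _≟_ (u ∷ us) (v ∷ vs) ≤ subCost _≟_ u v + ed _≟_ us vs
  ed-diag u v us vs = m⊓n≤m _ _

  ed-del : ∀ u us vs → ed _≟_ (u ∷ us) vs ≤ suc (ed _≟_ us vs)
  ed-del u []       []       = ≤-refl
  ed-del u (_ ∷ us) []       = ≤-refl
  ed-del u us       (v ∷ vs) = ≤-trans (m⊓n≤n _ _) (m⊓n≤m _ _)

  ed-ins : ∀ v us vs → ed _≟_ us (v ∷ vs) ≤ suc (ed _≟_ us vs)
  ed-ins v []       vs = ≤-refl
  ed-ins v (u ∷ us) vs = ≤-trans (m⊓n≤n _ _) (m⊓n≤n _ _)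

  module Grid (X Y : List A) where
    open Alignment (X !?_) (Y !?_) public

    D : ℕ → ℕ → ℕ → ℕ → ℕ
    D a b c d = ed _≟_ (frag _≟_ X a c) (frag _≟_ Y b d)

    D-whole : D 0 0 (length X) (length Y) ≡ ed _≟_ X Y
    D-whole = cong₂ (ed _≟_) (take-all (length X) X ≤-refl) (take-all (length Y) Y ≤-refl)

    InGrid : ℕ → ℕ → Set
    InGrid c d = c ≤ length X × d ≤ length Y

    D≤cost : ∀ {a b c d} (p : Path a b c d) → InGrid c d → D a b c d ≤ cost p
    D≤cost {a} {b} [] _ rewrite frag-empty X (≤-refl {a}) | frag-empty Y (≤-refl {b}) = z≤n
    D≤cost {a} {b} {c} {d} (diag p) g@(c≤n , d≤m)
      with frag-uncons X (proj₁ (start≤end p)) c≤n | frag-uncons Y (proj₂ (start≤end p)) d≤m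
    ... | u , Xa≡u , X≡ | v , Yb≡v , Y≡ rewrite Xa≡u | Yb≡v | X≡ | Y≡ =
      ≤-trans (ed-diag u v (frag _≟_ X (suc a) c) (frag _≟_ Y (suc b) d)) (+-monoʳ-≤ (subCost _≟_ u v) (D≤cost p g))
    D≤cost {a} {b} {c} {d} (del p) g@(c≤n , _) with frag-uncons X (proj₁ (start≤end p)) c≤n
    ... | u , _ , X≡ rewrite X≡ = ≤-trans (ed-del u (frag _≟_ X (suc a) c) (frag _≟_ Y b d)) (s≤s (D≤cost p g))
    D≤cost {a} {b} {c} {d} (ins p) g@(_ , d≤m) with frag-uncons Y (proj₂ (start≤end p)) d≤m
    ... | v , _ , Y≡ rewrite Y≡ = ≤-trans (ed-ins v (frag _≟_ X a c) (frag _≟_ Y (suc b) d)) (s≤s (D≤cost p g))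

    Optimal : ℕ → ℕ → ℕ → ℕ → Set
    Optimal a b c d = Σ (Path a b c d) λ p → cost p ≡ D a b c d

    private
      optimal-ins : ∀ {a b d} → b < d → d ≤ length Y → Optimal a (suc b) a d → Optimal a b a d
      optimal-ins {a} b<d d≤m (p , e) with frag-uncons Y b<d d≤m
      ... | _ , _ , Y≡ rewrite Y≡ | frag-empty X (≤-refl {a}) = ins p , cong suc e

      optimal-del : ∀ {a b c} → a < c → c ≤ length X → Optimal (suc a) b c b → Optimal a b c b
      optimal-del {a} {b} {c} a<c c≤n (p , e) with frag-uncons X a<c c≤n
      ... | _ , _ , X≡ rewrite X≡ | frag-empty Y (≤-refl {b}) =
        del p , cong suc (trans e (ed-[]ʳ (frag _≟_ X (suc a) c)))

      optimal-step : ∀ {a b c d} → a < c → b < d → InGrid c d →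
                     Optimal (suc a) (suc b) c d → Optimal (suc a) b c d → Optimal a (suc b) c d →
                     Optimal a b c d
      optimal-step {a} {b} {c} {d} a<c b<d (c≤n , d≤m) (p₁ , e₁) (p₂ , e₂) (p₃ , e₃)
        with frag-uncons X a<c c≤n | frag-uncons Y b<d d≤m
      ... | u , Xa≡u , X≡ | v , Yb≡v , Y≡ rewrite X≡ | Y≡
        with ⊓-sel (subCost _≟_ u v + D (suc a) (suc b) c d)
                   (suc (ed _≟_ (frag _≟_ X (suc a) c) (v ∷ frag _≟_ Y (suc b) d))
                    ⊓ suc (ed _≟_ (u ∷ frag _≟_ X (suc a) c) (frag _≟_ Y (suc b) d)))
      ... | inj₁ e rewrite e = diag p₁ , cong₂ _+_ (cong₂ matchCost Xa≡u Yb≡v) e₁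
      ... | inj₂ e rewrite e
        with ⊓-sel (suc (ed _≟_ (frag _≟_ X (suc a) c) (v ∷ frag _≟_ Y (suc b) d)))
                   (suc (ed _≟_ (u ∷ frag _≟_ X (suc a) c) (frag _≟_ Y (suc b) d)))
      ...   | inj₁ e′ rewrite e′ = del p₂ , cong suc e₂
      ...   | inj₂ e′ rewrite e′ = ins p₃ , cong suc e₃

      optimal′ : ∀ i j {a b c d} → c ≡ i + a → d ≡ j + b → InGrid c d → Optimal a b c d
      optimal′ zero zero {a} {b} refl refl _ rewrite frag-empty X (≤-refl {a}) | frag-empty Y (≤-refl {b}) = [] , refl
      optimal′ zero (suc j) {a} {b} refl refl g =
        optimal-ins (s≤s (m≤n+m b j)) (proj₂ g) (optimal′ zero j refl (sym (+-suc j b)) g)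
      optimal′ (suc i) zero {a} {b} refl refl g =
        optimal-del (s≤s (m≤n+m a i)) (proj₁ g) (optimal′ i zero (sym (+-suc i a)) refl g)
      optimal′ (suc i) (suc j) {a} {b} refl refl g =
        optimal-step (s≤s (m≤n+m a i)) (s≤s (m≤n+m b j)) g
          (optimal′ i j (sym (+-suc i a)) (sym (+-suc j b)) g)
          (optimal′ i (suc j) (sym (+-suc i a)) refl g)
          (optimal′ (suc i) j refl (sym (+-suc j b)) g)

    optimal : ∀ {a b c d} → a ≤ c → b ≤ d → InGrid c d → Optimal a b c d
    optimal {a} {b} {c} {d} a≤c b≤d = optimal′ (c ∸ a) (d ∸ b) (sym (m∸n+n≡m a≤c)) (sym (m∸n+n≡m b≤d))

    D-triangle : ∀ {a b r s c d} → a ≤ r → b ≤ s → r ≤ c → s ≤ d → InGrid c d →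
                 D a b c d ≤ D a b r s + D r s c d
    D-triangle {a} {b} {r} {s} {c} {d} a≤r b≤s r≤c s≤d g@(c≤n , d≤m)
      with optimal a≤r b≤s (≤-trans r≤c c≤n , ≤-trans s≤d d≤m) | optimal r≤c s≤d g
    ... | p , e | q , e′ = begin
      D a b c d               ≤⟨ D≤cost (p ++ₚ q) g ⟩
      cost (p ++ₚ q)          ≡⟨ cost-++ p q ⟩
      cost p + cost q         ≡⟨ cong₂ _+_ e e′ ⟩
      D a b r s + D r s c d   ∎
      where open ≤-Reasoning

    -- Replacing the stretch of an optimal alignment between two points by the corresponding
    -- stretch of another optimal alignment (one through (x , y)) keeps it optimal.
    anchor-splice : ∀ {a b c d a′ b′ c′ d′ r s x y r₂ s₂} → InGrid c d → InGrid c′ d′ →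
                    (P₁ : Path a b r s) (P₂ : Path r s x y) (P₃ : Path x y r₂ s₂) (P₄ : Path r₂ s₂ c d) →
                    (cost P₁ + cost P₂) + (cost P₃ + cost P₄) ≡ D a b c d →
                    (Q₁ : Path a′ b′ r s) (Q₂ : Path r s r₂ s₂) (Q₃ : Path r₂ s₂ c′ d′) →
                    cost Q₁ + (cost Q₂ + cost Q₃) ≡ D a′ b′ c′ d′ →
                    D a′ b′ c′ d′ ≡ D a′ b′ x y + D x y c′ d′
    anchor-splice {a} {b} {c} {d} {a′} {b′} {c′} {d′} {r} {s} {x} {y} g g′@(c′≤n , d′≤m) P₁ P₂ P₃ P₄ eP Q₁ Q₂ Q₃ eQ =
      ≤-antisym (D-triangle a′≤x b′≤y x≤c′ y≤d′ g′) (begin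
        D a′ b′ x y + D x y c′ d′                  ≤⟨ +-mono-≤ (D≤cost (Q₁ ++ₚ P₂) (x≤n , y≤m)) (D≤cost (P₃ ++ₚ Q₃) g′) ⟩
        cost (Q₁ ++ₚ P₂) + cost (P₃ ++ₚ Q₃)         ≡⟨ cong₂ _+_ (cost-++ Q₁ P₂) (cost-++ P₃ Q₃) ⟩
        (cost Q₁ + cost P₂) + (cost P₃ + cost Q₃)   ≡⟨ regroup (cost Q₁) (cost P₂) (cost P₃) (cost Q₃) ⟩
        cost Q₁ + ((cost P₂ + cost P₃) + cost Q₃)   ≤⟨ +-monoʳ-≤ (cost Q₁) (+-monoˡ-≤ (cost Q₃) P₂P₃≤Q₂) ⟩
        cost Q₁ + (cost Q₂ + cost Q₃)               ≡⟨ eQ ⟩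
        D a′ b′ c′ d′                              ∎)
      where
        open ≤-Reasoning
        regroup : ∀ a b c d → (a + b) + (c + d) ≡ a + ((b + c) + d)
        regroup = solve-∀
        x≤r₂ = proj₁ (start≤end P₃)
        y≤s₂ = proj₂ (start≤end P₃)
        x≤c′ = ≤-trans x≤r₂ (proj₁ (start≤end Q₃))
        y≤d′ = ≤-trans y≤s₂ (proj₂ (start≤end Q₃))
        x≤n = ≤-trans x≤c′ c′≤n
        y≤m = ≤-trans y≤d′ d′≤m
        a′≤x = ≤-trans (proj₁ (start≤end Q₁)) (proj₁ (start≤end P₂))
        b′≤y = ≤-trans (proj₂ (start≤end Q₁)) (proj₂ (start≤end P₂))
        P₂P₃≤Q₂ : cost P₂ + cost P₃ ≤ cost Q₂
        P₂P₃≤Q₂ = +-cancelʳ-≤ (cost P₄) _ _ (+-cancelˡ-≤ (cost P₁) _ _ (begin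
          cost P₁ + ((cost P₂ + cost P₃) + cost P₄)   ≡⟨ sym (regroup (cost P₁) (cost P₂) (cost P₃) (cost P₄)) ⟩
          (cost P₁ + cost P₂) + (cost P₃ + cost P₄)   ≡⟨ eP ⟩
          D a b c d                                   ≤⟨ D≤cost (P₁ ++ₚ (Q₂ ++ₚ P₄)) g ⟩
          cost (P₁ ++ₚ (Q₂ ++ₚ P₄))                   ≡⟨ trans (cost-++ P₁ _) (cong (cost P₁ +_) (cost-++ Q₂ P₄)) ⟩
          cost P₁ + (cost Q₂ + cost P₄)               ∎))

  lcp≤length : ∀ us vs → lcp _≟_ us vs ≤ length vs
  lcp≤length []       vs       = z≤n
  lcp≤length (u ∷ us) []       = z≤n
  lcp≤length (u ∷ us) (v ∷ vs) with u ≟ v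
  ... | yes _ = s≤s (lcp≤length us vs)
  ... | no _  = z≤n

  lcp-∷ : ∀ u us vs → lcp _≟_ (u ∷ us) (u ∷ vs) ≡ suc (lcp _≟_ us vs)
  lcp-∷ u us vs with u ≟ u
  ... | yes _  = refl
  ... | no u≢u = ⊥-elim (u≢u refl)

  lcp-drop₁ : ∀ {ℓ} us vs → suc ℓ ≤ lcp _≟_ us vs → ℓ ≤ lcp _≟_ (drop 1 us) (drop 1 vs)
  lcp-drop₁ (u ∷ us) (v ∷ vs) h with u ≟ v
  lcp-drop₁ (u ∷ us) (v ∷ vs) h  | yes _ = ≤-pred h
  lcp-drop₁ (u ∷ us) (v ∷ vs) () | no _

  drop-suc : ∀ q (S : List A) → drop (suc q) S ≡ drop 1 (drop q S)
  drop-suc zero    S       = refl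
  drop-suc (suc q) []      = refl
  drop-suc (suc q) (_ ∷ S) = drop-suc q S

  !?⇒drop : ∀ (S : List A) q {u} → S !? q ≡ just u → drop q S ≡ u ∷ drop (suc q) S
  !?⇒drop (v ∷ S) zero    refl = refl
  !?⇒drop (v ∷ S) (suc q) e    = !?⇒drop S q e

  -- Parse p t: a factorisation of S[p ..] into t phrases, each a single letter or a copy of a
  -- fragment that also starts at an earlier position.
  module Parsing (S : List A) where

    Occurs : ℕ → ℕ → ℕ → Set
    Occurs q p ℓ = q < p × ℓ ≤ lcp _≟_ (drop q S) (drop p S)

    data Parse : ℕ → ℕ → Set where
      end     : Parse (length S) 0
      literal : ∀ {p t} → p < length S → Parse (suc p) t → Parse p (suc t)
      copy    : ∀ {p t q ℓ} → Occurs q p (suc ℓ) → p + suc ℓ ≤ length S → Parse (p + suc ℓ) t →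
                Parse p (suc t)

    occurs-shift : ∀ {q p ℓ} → Occurs q p (suc ℓ) → Occurs (suc q) (suc p) ℓ
    occurs-shift {q} {p} {ℓ} (q<p , h) = s≤s q<p ,
      subst₂ (λ u v → ℓ ≤ lcp _≟_ u v) (sym (drop-suc q S)) (sym (drop-suc p S)) (lcp-drop₁ (drop q S) (drop p S) h)

    parse-suc : ∀ {p t} → Parse p t → p < length S → Σ ℕ λ t′ → t′ ≤ t × Parse (suc p) t′
    parse-suc end                          p<n = ⊥-elim (<-irrefl refl p<n)
    parse-suc (literal {t = t} _ π)        _   = t , n≤1+n t , π
    parse-suc (copy {p} {t} {ℓ = zero} _ _ π) _ = t , n≤1+n t , subst (λ z → Parse z t) (+-comm p 1) π
    parse-suc (copy {p} {t} {ℓ = suc ℓ} o le π) _ =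
      suc t , ≤-refl , copy (occurs-shift o) (subst (_≤ length S) (+-suc p (suc ℓ)) le)
                             (subst (λ z → Parse z t) (+-suc p (suc ℓ)) π)

    parse-+ : ∀ i {p t} → Parse p t → p + i ≤ length S → Σ ℕ λ t′ → t′ ≤ t × Parse (p + i) t′
    parse-+ zero    {p} {t} π _ = t , ≤-refl , subst (λ z → Parse z t) (sym (+-identityʳ p)) π
    parse-+ (suc i) {p} π le with parse-suc π (<-≤-trans (m<m+n p (s≤s z≤n)) le)
    ... | t₁ , t₁≤t , π₁ with parse-+ i π₁ (subst (_≤ length S) (+-suc p i) le)
    ...   | t₂ , t₂≤t₁ , π₂ = t₂ , ≤-trans t₂≤t₁ t₁≤t , subst (λ z → Parse z t₂) (sym (+-suc p i)) π₂

    parse-suffix : ∀ {p p′ t} → Parse p t → p ≤ p′ → p′ ≤ length S → Σ ℕ λ t′ → t′ ≤ t × Parse p′ t′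
    parse-suffix {p} {p′} π p≤p′ p′≤n with parse-+ (p′ ∸ p) π (subst (_≤ length S) (sym (m+[n∸m]≡n p≤p′)) p′≤n)
    ... | t′ , t′≤t , π′ = t′ , t′≤t , subst (λ z → Parse z t′) (m+[n∸m]≡n p≤p′) π′

    lcp≤lpf : ∀ {q p} → q < p → lcp _≟_ (drop q S) (drop p S) ≤ lpf _≟_ S p
    lcp≤lpf {q} {p} = foldr-⊔-≥ (λ q → lcp _≟_ (drop q S) (drop p S)) id p

    lpf≤remaining : ∀ p → lpf _≟_ S p ≤ length S ∸ p
    lpf≤remaining p = foldr-⊔-≤ (λ q → lcp _≟_ (drop q S) (drop p S)) (upTo p)
      (λ q → subst (lcp _≟_ (drop q S) (drop p S) ≤_) (length-drop p S) (lcp≤length (drop q S) (drop p S)))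

    phrase : ℕ → ℕ
    phrase p = 1 ⊔ lpf _≟_ S p

    phrase-nonempty : ∀ p → suc p ≤ p + phrase p
    phrase-nonempty p = subst (_≤ p + phrase p) (+-comm p 1) (+-monoʳ-≤ p (m≤m⊔n 1 (lpf _≟_ S p)))

    phrase-fits : ∀ {p} → p < length S → p + phrase p ≤ length S
    phrase-fits {p} p<n = subst (p + phrase p ≤_) (m+[n∸m]≡n (<⇒≤ p<n))
      (+-monoʳ-≤ p (⊔-lub (m<n⇒0<n∸m p<n) (lpf≤remaining p)))

    -- No phrase of any factorisation starting at p is longer than the greedy one.
    parse-skip-phrase : ∀ {p t} → Parse p t → p < length S → Σ ℕ λ t′ → suc t′ ≤ t × Parse (p + phrase p) t′
    parse-skip-phrase end p<n = ⊥-elim (<-irrefl refl p<n)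
    parse-skip-phrase {p} (literal _ π) p<n
      with parse-suffix π (phrase-nonempty p) (phrase-fits p<n)
    ... | t′ , t′≤t , π′ = t′ , s≤s t′≤t , π′
    parse-skip-phrase {p} (copy (q<p , ℓ≤lcp) _ π) p<n
      with parse-suffix π (+-monoʳ-≤ p (≤-trans (≤-trans ℓ≤lcp (lcp≤lpf q<p)) (m≤n⊔m 1 (lpf _≟_ S p))))
                          (phrase-fits p<n)
    ... | t′ , t′≤t , π′ = t′ , s≤s t′≤t , π′

    lzFrom-optimal : ∀ fuel {p t} → length S ≤ fuel + p → Parse p t → length (lzFrom _≟_ fuel S p) ≤ t
    lzFrom-optimal zero _ _ = z≤n
    lzFrom-optimal (suc fuel) {p} n≤fuel+p π with length S ≤? p
    ... | yes _   = z≤n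
    ... | no  n≰p with parse-skip-phrase π (≰⇒> n≰p)
    ...   | t′ , t′<t , π′ = ≤-trans (s≤s (lzFrom-optimal fuel n≤fuel′ π′)) t′<t
      where
        n≤fuel′ : length S ≤ fuel + (p + phrase p)
        n≤fuel′ = ≤-trans n≤fuel+p (begin
          suc fuel + p          ≡⟨ +-suc fuel p ⟨
          fuel + suc p          ≤⟨ +-monoʳ-≤ fuel (phrase-nonempty p) ⟩
          fuel + (p + phrase p) ∎)
          where open ≤-Reasoning

    lzSize≤parse : ∀ {t} → Parse 0 t → lzSize _≟_ S ≤ t
    lzSize≤parse = lzFrom-optimal (length S) (≤-reflexive (sym (+-identityʳ (length S))))

    literals-before : ∀ {p t} → p ≤ length S → Parse p t → Parse 0 (t + p)
    literals-before {zero}  {t} _   π = subst (Parse 0) (sym (+-identityʳ t)) π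
    literals-before {suc p} {t} p<n π = subst (Parse 0) (sym (+-suc t p)) (literals-before (<⇒≤ p<n) (literal p<n π))

    lzSize≤length : lzSize _≟_ S ≤ length S
    lzSize≤length = lzSize≤parse (literals-before ≤-refl end)

  -- T spells X(lo .. x] backwards. Two alignments of X(lo + 1 .. x] that do not meet are walked
  -- column by column; where both match rows r < r₂ with the same letter of Y we get X[r] = X[r₂],
  -- and row r₂ comes first in T, so runs of such rows are copies. Every other row is paid for by
  -- an edit, hence T has a factorisation with O(cost) phrases.
  module DisjointAlignments (X Y T : List A) (x lo : ℕ) (length-T : length T ≡ x ∸ lo)
                            (T-spells : ∀ r → lo ≤ r → r < x → T !? (x ∸ suc r) ≡ X !? r) where
    open Grid X Y
    open Parsing T

    row<length : ∀ {r} → lo ≤ r → r < x → x ∸ suc r < length T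
    row<length lo≤r r<x = subst (_ <_) (sym length-T) (∸-monoʳ-< (s≤s lo≤r) r<x)

    row≤length : ∀ {r} → lo ≤ r → x ∸ r ≤ length T
    row≤length {r} lo≤r = subst (x ∸ r ≤_) (sym length-T) (∸-monoʳ-≤ x lo≤r)

    literal-row : ∀ {r t} → lo ≤ r → r < x → Parse (x ∸ r) t → Parse (x ∸ suc r) (suc t)
    literal-row {t = t} lo≤r r<x π = literal (row<length lo≤r r<x) (subst (λ z → Parse z t) (∸-suc r<x) π)

    drop-row : ∀ {r u} → lo ≤ r → r < x → X !? r ≡ just u → drop (x ∸ suc r) T ≡ u ∷ drop (x ∸ r) T
    drop-row {r} {u} lo≤r r<x e = trans (!?⇒drop T (x ∸ suc r) (trans (T-spells r lo≤r r<x) e))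
                                        (cong (λ z → u ∷ drop z T) (sym (∸-suc r<x)))

    occurs-rows : ∀ {r r₂ u ℓ} → lo ≤ r → r < r₂ → r₂ < x → X !? r ≡ just u → X !? r₂ ≡ just u →
                  ℓ ≤ lcp _≟_ (drop (x ∸ r₂) T) (drop (x ∸ r) T) → Occurs (x ∸ suc r₂) (x ∸ suc r) (suc ℓ)
    occurs-rows {r} {r₂} {u} {ℓ} lo≤r r<r₂ r₂<x e e₂ h = ∸-monoʳ-< (s≤s r<r₂) r₂<x ,
      subst₂ (λ v w → suc ℓ ≤ lcp _≟_ v w)
        (sym (drop-row (≤-trans lo≤r (<⇒≤ r<r₂)) r₂<x e₂)) (sym (drop-row lo≤r (<-trans r<r₂ r₂<x) e))
        (subst (suc ℓ ≤_) (sym (lcp-∷ u (drop (x ∸ r₂) T) (drop (x ∸ r) T))) (s≤s h))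

    -- The factorisation of T from row r on built so far; when copying, its first phrase is an
    -- occurrence of the text at row r₂, lengthened by one letter at each further match.
    data Partial (r r₂ : ℕ) : ℕ → Set where
      settled : ∀ {t} → Parse (x ∸ r) t → Partial r r₂ t
      copying : ∀ {t ℓ} → Occurs (x ∸ r₂) (x ∸ r) (suc ℓ) → x ∸ r + suc ℓ ≤ length T →
                Parse (x ∸ r + suc ℓ) t → Partial r r₂ (suc t)

    settle : ∀ {r r₂ t} → Partial r r₂ t → Parse (x ∸ r) t
    settle (settled π)      = π
    settle (copying o le π) = copy o le π

    slack : ∀ {r r₂ t} → Partial r r₂ t → ℕ
    slack (settled _)     = 1
    slack (copying _ _ _) = 0

    data Outcome {a b c d a′ b′ c′ d′} (R : Path a b c d) (L : Path a′ b′ c′ d′) (B : ℕ) : Set where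
      meet   : Meet R L → Outcome R L B
      parsed : ∀ {t} → Parse 0 t → t ≤ B → Outcome R L B

    outcome-map : ∀ {a b c d a′ b′ c′ d′ a₂ b₂ c₂ d₂ a₂′ b₂′ c₂′ d₂′}
                    {R : Path a b c d} {L : Path a′ b′ c′ d′} {R₂ : Path a₂ b₂ c₂ d₂} {L₂ : Path a₂′ b₂′ c₂′ d₂′}
                    {B B₂} →
                  (∀ {r s} → Through R r s → Through R₂ r s) → (∀ {r s} → Through L r s → Through L₂ r s) →
                  B ≤ B₂ → Outcome R L B → Outcome R₂ L₂ B₂
    outcome-map f g _   (meet (r , s , t , t′)) = meet (r , s , f t , g t′)
    outcome-map f g B≤B₂ (parsed π le)          = parsed π (≤-trans le B≤B₂)

    private
      del-behind : ∀ t w c d D → t + w + 2 * (suc c + d) + D ≡ (suc t + 1 + 2 * (c + d) + D) + w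
      del-behind = solve-∀
      del-ahead : ∀ t w c d D → t + w + 2 * (c + suc d) + D ≡ (t + 1 + 2 * (c + d) + D) + (w + 1)
      del-ahead = solve-∀
      ins-both : ∀ t w c d D → t + w + 2 * (suc c + suc d) + D ≡ (t + 1 + 2 * (c + d) + D) + (w + 3)
      ins-both = solve-∀
      ins-behind : ∀ t w c d m D → t + w + 2 * (suc c + (m + d)) + D ≡ (t + 1 + 2 * (c + d) + D) + (w + 1 + 2 * m)
      ins-behind = solve-∀
      ins-ahead : ∀ t w c d m D → t + w + 2 * (m + c + suc d) + D ≡ (suc t + 1 + 2 * (c + d) + D) + (w + 2 * m)
      ins-ahead = solve-∀
      mismatch-behind : ∀ t w c d m m₂ D →
        t + w + 2 * (suc m + c + (m₂ + d)) + D ≡ (suc t + 1 + 2 * (c + d) + D) + (w + 2 * m + 2 * m₂)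
      mismatch-behind = solve-∀
      mismatch-ahead : ∀ t w c d m₂ D →
        t + w + 2 * (c + (suc m₂ + d)) + D ≡ (suc t + 1 + 2 * (c + d) + D) + (w + 2 * m₂)
      mismatch-ahead = solve-∀
      match-settled : ∀ t c D → t + 1 + c + D ≡ suc t + 0 + c + D
      match-settled = solve-∀
      finish : ∀ t w c D → t + w + 2 * (c + 0) + D ≡ (t + (D + c)) + (w + c)
      finish = solve-∀

    -- The bound is a
    -- potential: each edit of R or L pays for two phrases, and a settled factorisation keeps one
    -- phrase in reserve for the copy that the next match opens.
    walk : ∀ {r s r₂ uE vE t} (R : Path r s x uE) (L : Path r₂ s x vE) → r < r₂ → lo ≤ r →
           (π : Partial r r₂ t) → Outcome R L (t + slack π + 2 * (cost R + cost L) + (uE ∸ vE))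

    walk-match : ∀ {r s r₂ uE vE t u} (R : Path (suc r) (suc s) x uE) (L : Path (suc r₂) (suc s) x vE) →
                 r < r₂ → lo ≤ r → X !? r ≡ just u → X !? r₂ ≡ just u →
                 (π : Partial r r₂ t) → Outcome (diag R) (diag L) (t + slack π + 2 * (cost R + cost L) + (uE ∸ vE))

    walk [] L r<r₂ _ _ = ⊥-elim (<-irrefl refl (<-≤-trans r<r₂ (proj₁ (start≤end L))))
    walk {r} {s} {r₂} {uE} {vE} {t} (del R) L r<r₂ lo≤r π with suc r ≟ℕ r₂
    ... | yes refl = meet (suc r , s , (del [] , R , refl) , through-start L)
    ... | no r+1≢r₂ =
      outcome-map (through-del {p = R}) id (≤-by (slack π) (del-behind t (slack π) (cost R) (cost L) (uE ∸ vE)))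
        (walk R L (≤∧≢⇒< r<r₂ r+1≢r₂) (≤-trans lo≤r (n≤1+n r))
          (settled (literal-row lo≤r (proj₁ (start≤end R)) (settle π))))
    walk {r} {s} {r₂} {uE} {vE} {t} R [] r<r₂ lo≤r π =
      parsed (literals-before (row≤length lo≤r) (settle π))
        (≤-trans (+-monoʳ-≤ t (rows≤cols+cost R)) (≤-by (slack π + cost R) (finish t (slack π) (cost R) (uE ∸ vE))))
    walk {r} {s} {r₂} {uE} {vE} {t} R (del L) r<r₂ lo≤r π =
      outcome-map id (through-del {p = L}) (≤-by (slack π + 1) (del-ahead t (slack π) (cost R) (cost L) (uE ∸ vE)))
        (walk R L (<-trans r<r₂ (n<1+n r₂)) lo≤r (settled (settle π)))
    walk {r} {s} {r₂} {uE} {vE} {t} (ins R) (ins L) r<r₂ lo≤r π =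
      outcome-map (through-ins {p = R}) (through-ins {p = L})
        (≤-by (slack π + 3) (ins-both t (slack π) (cost R) (cost L) (uE ∸ vE)))
        (walk R L r<r₂ lo≤r (settled (settle π)))
    walk {r} {s} {r₂} {uE} {vE} {t} (ins R) (diag L) r<r₂ lo≤r π =
      outcome-map (through-ins {p = R}) (through-diag {p = L})
        (≤-by _ (ins-behind t (slack π) (cost R) (cost L) (matchCost (X !? r₂) (Y !? s)) (uE ∸ vE)))
        (walk R L (<-trans r<r₂ (n<1+n r₂)) lo≤r (settled (settle π)))
    walk {r} {s} {r₂} {uE} {vE} {t} (diag R) (ins L) r<r₂ lo≤r π with suc r ≟ℕ r₂
    ... | yes refl = meet (suc r , suc s , (diag [] , R , cong (_+ cost R) (+-identityʳ _)) , (ins [] , L , refl))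
    ... | no r+1≢r₂ =
      outcome-map (through-diag {p = R}) (through-ins {p = L})
        (≤-by _ (ins-ahead t (slack π) (cost R) (cost L) (matchCost (X !? r) (Y !? s)) (uE ∸ vE)))
        (walk R L (≤∧≢⇒< r<r₂ r+1≢r₂) (≤-trans lo≤r (n≤1+n r))
          (settled (literal-row lo≤r (proj₁ (start≤end R)) (settle π))))
    walk {r} {s} {r₂} {uE} {vE} {t} (diag R) (diag L) r<r₂ lo≤r π
      with matchCost (X !? r) (Y !? s) in e | matchCost (X !? r₂) (Y !? s) in e₂
    ... | suc m | m₂ =
      outcome-map (through-diag {p = R}) (through-diag {p = L})
        (≤-by _ (mismatch-behind t (slack π) (cost R) (cost L) m m₂ (uE ∸ vE)))
        (walk R L (s≤s r<r₂) (≤-trans lo≤r (n≤1+n r)) (settled (literal-row lo≤r (proj₁ (start≤end R)) (settle π))))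
    ... | zero | suc m₂ =
      outcome-map (through-diag {p = R}) (through-diag {p = L})
        (≤-by _ (mismatch-ahead t (slack π) (cost R) (cost L) m₂ (uE ∸ vE)))
        (walk R L (s≤s r<r₂) (≤-trans lo≤r (n≤1+n r)) (settled (literal-row lo≤r (proj₁ (start≤end R)) (settle π))))
    ... | zero | zero with matchCost≡0 _ _ e | matchCost≡0 _ _ e₂
    ...   | u , Xr≡u , Ys≡u | _ , Xr₂≡u₂ , Ys≡u₂ with trans (sym Ys≡u) Ys≡u₂
    ...     | refl = walk-match R L r<r₂ lo≤r Xr≡u Xr₂≡u₂ π

    walk-match {r} {s} {r₂} {uE} {vE} {t} R L r<r₂ lo≤r Xr≡u Xr₂≡u (settled π) =
      outcome-map (through-diag {p = R}) (through-diag {p = L})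
        (≤-reflexive (sym (match-settled t (2 * (cost R + cost L)) (uE ∸ vE))))
        (walk R L (s≤s r<r₂) (≤-trans lo≤r (n≤1+n r))
          (copying {ℓ = 0} (occurs-rows lo≤r r<r₂ (proj₁ (start≤end L)) Xr≡u Xr₂≡u z≤n)
            (subst (_≤ length T) x∸r≡ (row≤length lo≤r)) (subst (λ z → Parse z t) x∸r≡ π)))
      where
        x∸r≡ : x ∸ r ≡ x ∸ suc r + 1
        x∸r≡ = trans (∸-suc (proj₁ (start≤end R))) (+-comm 1 _)
    walk-match {r} {s} {r₂} R L r<r₂ lo≤r Xr≡u Xr₂≡u (copying {t′} {ℓ} (_ , ℓ≤lcp) le π) =
      outcome-map (through-diag {p = R}) (through-diag {p = L}) ≤-refl
        (walk R L (s≤s r<r₂) (≤-trans lo≤r (n≤1+n r))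
          (copying {ℓ = suc ℓ} (occurs-rows lo≤r r<r₂ (proj₁ (start≤end L)) Xr≡u Xr₂≡u ℓ≤lcp)
            (subst (_≤ length T) x∸r+ℓ≡ le) (subst (λ z → Parse z t′) x∸r+ℓ≡ π)))
      where
        x∸r+ℓ≡ : x ∸ r + suc ℓ ≡ x ∸ suc r + suc (suc ℓ)
        x∸r+ℓ≡ = trans (cong (_+ suc ℓ) (∸-suc (proj₁ (start≤end R)))) (sym (+-suc (x ∸ suc r) (suc ℓ)))

    private
      budget-mono : ∀ {w w′ δ δ′} → w ≤ w′ → δ ≤ δ′ → 2 + 2 * w + δ ≤ 2 + 2 * w′ + δ′
      budget-mono w≤w′ δ≤δ′ = +-mono-≤ (+-monoʳ-≤ 2 (*-monoʳ-≤ 2 w≤w′)) δ≤δ′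

      literal-lo : lo < x → Parse (x ∸ suc lo) 1
      literal-lo lo<x = literal-row ≤-refl lo<x (subst (λ z → Parse z 0) length-T end)

    -- L catches up with the column u₀ where R starts.
    start : ∀ {r₂ s₂ u₀ uE vE} (R : Path (suc lo) u₀ x uE) (L : Path r₂ s₂ x vE) → suc lo ≤ r₂ → s₂ ≤ u₀ →
            Outcome R L (2 + 2 * (cost R + cost L) + (uE ∸ vE))
    start {r₂} {s₂} {u₀} R L lo<r₂ s₂≤u₀ with s₂ ≟ℕ u₀
    start {r₂} R L lo<r₂ _ | yes refl with suc lo ≟ℕ r₂
    ... | yes refl     = meet (suc lo , _ , through-start R , through-start L)
    ... | no lo+1≢r₂   = walk R L (≤∧≢⇒< lo<r₂ lo+1≢r₂) (n≤1+n lo) (settled (literal-lo (proj₁ (start≤end R))))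
    start {r₂} {s₂} {u₀} {uE} R [] lo<r₂ s₂≤u₀ | no _ =
      parsed (literals-before (row≤length (n≤1+n lo)) (literal-lo (proj₁ (start≤end R)))) (begin
        1 + (x ∸ suc lo)                     ≤⟨ s≤s (rows≤cols+cost R) ⟩
        1 + ((uE ∸ u₀) + cost R)             ≤⟨ s≤s (+-monoˡ-≤ (cost R) (∸-monoʳ-≤ uE s₂≤u₀)) ⟩
        1 + ((uE ∸ s₂) + cost R)             ≤⟨ ≤-by (1 + cost R) (budget-tail (cost R) (uE ∸ s₂)) ⟩
        2 + 2 * (cost R + 0) + (uE ∸ s₂)     ∎)
      where
        open ≤-Reasoning
        budget-tail : ∀ c δ → 2 + 2 * (c + 0) + δ ≡ 1 + (δ + c) + (1 + c)
        budget-tail = solve-∀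
    start R (diag L) lo<r₂ s₂≤u₀ | no s₂≢u₀ =
      outcome-map id (through-diag {p = L}) (budget-mono (+-monoʳ-≤ (cost R) (m≤n+m _ _)) ≤-refl)
        (start R L (≤-trans lo<r₂ (n≤1+n _)) (≤∧≢⇒< s₂≤u₀ s₂≢u₀))
    start R (del L) lo<r₂ s₂≤u₀ | no _ =
      outcome-map id (through-del {p = L}) (budget-mono (+-monoʳ-≤ (cost R) (n≤1+n _)) ≤-refl)
        (start R L (≤-trans lo<r₂ (n≤1+n _)) s₂≤u₀)
    start R (ins L) lo<r₂ s₂≤u₀ | no s₂≢u₀ =
      outcome-map id (through-ins {p = L}) (budget-mono (+-monoʳ-≤ (cost R) (n≤1+n _)) ≤-refl)
        (start R L lo<r₂ (≤∧≢⇒< s₂≤u₀ s₂≢u₀))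

    meet-or-lz-bounded : ∀ {u₀ uE v₀ vE} (U : Path (suc lo) u₀ x uE) (V : Path (suc lo) v₀ x vE) →
                         Meet U V ⊎ lzSize _≟_ T ≤ 2 + 2 * (cost U + cost V) + ∣ uE - vE ∣
    meet-or-lz-bounded {u₀} {uE} {v₀} {vE} U V with <-cmp u₀ v₀
    ... | tri≈ _ refl _ = inj₁ (suc lo , u₀ , through-start U , through-start V)
    ... | tri> _ _ v₀<u₀ with start U V ≤-refl (<⇒≤ v₀<u₀)
    ...   | meet m        = inj₁ m
    ...   | parsed π t≤B  = inj₂ (≤-trans (lzSize≤parse π)
                              (≤-trans t≤B (budget-mono {cost U + cost V} ≤-refl (m∸n≤∣m-n∣ uE vE))))
    meet-or-lz-bounded {u₀} {uE} {v₀} {vE} U V | tri< u₀<v₀ _ _ with start V U ≤-refl (<⇒≤ u₀<v₀)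
    ...   | meet (r , s , t , t′) = inj₁ (r , s , t′ , t)
    ...   | parsed π t≤B  = inj₂ (≤-trans (lzSize≤parse π)
                              (≤-trans t≤B (budget-mono (≤-reflexive (+-comm (cost V) (cost U)))
                                (subst (vE ∸ uE ≤_) (∣-∣-comm vE uE) (m∸n≤∣m-n∣ vE uE)))))

  ∷ʳ-!?-< : ∀ (us : List A) u {i} → i < length us → (us ∷ʳ u) !? i ≡ us !? i
  ∷ʳ-!?-< (_ ∷ us) u {zero}  _         = refl
  ∷ʳ-!?-< (_ ∷ us) u {suc i} (s≤s i<n) = ∷ʳ-!?-< us u i<n

  ∷ʳ-!?-length : ∀ (us : List A) u → (us ∷ʳ u) !? length us ≡ just u
  ∷ʳ-!?-length []       u = refl
  ∷ʳ-!?-length (_ ∷ us) u = ∷ʳ-!?-length us u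

  reverse-!? : ∀ (us : List A) {i} → i < length us → reverse us !? i ≡ us !? (length us ∸ suc i)
  reverse-!? (u ∷ us) {i} i<n rewrite unfold-reverse u us with m≤n⇒m<n∨m≡n (≤-pred i<n)
  ... | inj₁ i<m = trans (∷ʳ-!?-< (reverse us) u (subst (i <_) (sym (length-reverse us)) i<m))
                         (trans (reverse-!? us i<m) (cong ((u ∷ us) !?_) (sym (∸-suc i<m))))
  ... | inj₂ refl rewrite n∸n≡0 (length us) =
    trans (cong ((reverse us ∷ʳ u) !?_) (sym (length-reverse us))) (∷ʳ-!?-length (reverse us) u)

  take-!? : ∀ k (us : List A) {i} → i < k → take k us !? i ≡ us !? i
  take-!? (suc k) []       _         = refl
  take-!? (suc k) (u ∷ us) {zero}  _ = refl
  take-!? (suc k) (u ∷ us) {suc i} (s≤s i<k) = take-!? k us i<k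

  drop-!? : ∀ a (us : List A) i → drop a us !? i ≡ us !? (a + i)
  drop-!? zero    us       i = refl
  drop-!? (suc a) []       i = refl
  drop-!? (suc a) (u ∷ us) i = drop-!? a us i

  frag-!? : ∀ X {a c i} → i < c ∸ a → frag _≟_ X a c !? i ≡ X !? (a + i)
  frag-!? X {a} {c} {i} i<c-a = trans (take-!? (c ∸ a) (drop a X) i<c-a) (drop-!? a X i)

  module Reversal (fX fY gX gY : ℕ → Maybe A) (N M : ℕ)
                  (gX≡fX : ∀ r → r < N → gX (N ∸ suc r) ≡ fX r)
                  (gY≡fY : ∀ s → s < M → gY (M ∸ suc s) ≡ fY s) where
    module F = Alignment fX fY
    module G = Alignment gX gY

    cast : ∀ {a b c d a′ b′ c′ d′} → a ≡ a′ → b ≡ b′ → c ≡ c′ → d ≡ d′ → G.Path a b c d → G.Path a′ b′ c′ d′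
    cast refl refl refl refl p = p

    cost-cast : ∀ {a b c d a′ b′ c′ d′} (e₁ : a ≡ a′) (e₂ : b ≡ b′) (e₃ : c ≡ c′) (e₄ : d ≡ d′) (p : G.Path a b c d) →
                G.cost (cast e₁ e₂ e₃ e₄ p) ≡ G.cost p
    cost-cast refl refl refl refl p = refl

    reverse-path : ∀ {a b c d} (p : F.Path a b c d) → c ≤ N → d ≤ M →
                   Σ (G.Path (N ∸ c) (M ∸ d) (N ∸ a) (M ∸ b)) λ q → G.cost q ≡ F.cost p
    reverse-path F.[] _ _ = G.[] , refl
    reverse-path {a} {b} (F.diag p) c≤N d≤M with F.start≤end p | reverse-path p c≤N d≤M
    ... | a<c , b<d | q , e = q G.++ₚ step , (begin
      G.cost (q G.++ₚ step)          ≡⟨ G.cost-++ q step ⟩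
      G.cost q + G.cost step         ≡⟨ cong₂ _+_ e (cost-cast refl refl N∸a≡ M∸b≡ (G.diag G.[])) ⟩
      F.cost p + (matchCost (gX (N ∸ suc a)) (gY (M ∸ suc b)) + 0)
        ≡⟨ cong (F.cost p +_) (trans (+-identityʳ _) (cong₂ matchCost (gX≡fX a a<N) (gY≡fY b b<M))) ⟩
      F.cost p + matchCost (fX a) (fY b) ≡⟨ +-comm (F.cost p) _ ⟩
      F.cost (F.diag p)              ∎)
      where
        open ≡-Reasoning
        a<N = <-≤-trans a<c c≤N
        b<M = <-≤-trans b<d d≤M
        N∸a≡ = sym (∸-suc a<N)
        M∸b≡ = sym (∸-suc b<M)
        step = cast refl refl N∸a≡ M∸b≡ (G.diag G.[])
    reverse-path {a} (F.del p) c≤N d≤M with F.start≤end p | reverse-path p c≤N d≤M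
    ... | a<c , _ | q , e = q G.++ₚ step ,
      trans (G.cost-++ q step)
            (trans (cong₂ _+_ e (cost-cast refl refl N∸a≡ refl (G.del G.[]))) (+-comm (F.cost p) 1))
      where
        N∸a≡ = sym (∸-suc (<-≤-trans a<c c≤N))
        step = cast refl refl N∸a≡ refl (G.del G.[])
    reverse-path {b = b} (F.ins p) c≤N d≤M with F.start≤end p | reverse-path p c≤N d≤M
    ... | _ , b<d | q , e = q G.++ₚ step ,
      trans (G.cost-++ q step)
            (trans (cong₂ _+_ e (cost-cast refl refl refl M∸b≡ (G.ins G.[]))) (+-comm (F.cost p) 1))
      where
        M∸b≡ = sym (∸-suc (<-≤-trans b<d d≤M))
        step = cast refl refl refl M∸b≡ (G.ins G.[])

  module Reversed (X Y : List A) where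
    open Grid X Y
    module Rev = Grid (reverse X) (reverse Y)

    private
      n∸[n∸1+r]-1≡r : ∀ n {r} → r < n → n ∸ suc (n ∸ suc r) ≡ r
      n∸[n∸1+r]-1≡r n r<n = trans (cong (n ∸_) (sym (∸-suc r<n))) (m∸[m∸n]≡n (<⇒≤ r<n))

      reverse-!?-flip : ∀ (us : List A) {r} → r < length us → reverse us !? (length us ∸ suc r) ≡ us !? r
      reverse-!?-flip us {r} r<n = trans (reverse-!? us (∸-monoʳ-< {length us} (s≤s z≤n) r<n))
                                         (cong (us !?_) (n∸[n∸1+r]-1≡r (length us) r<n))

      module Fwd = Reversal (X !?_) (Y !?_) (reverse X !?_) (reverse Y !?_) (length X) (length Y)
                            (λ r → reverse-!?-flip X) (λ s → reverse-!?-flip Y)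
      module Bwd = Reversal (reverse X !?_) (reverse Y !?_) (X !?_) (Y !?_) (length X) (length Y)
                            (λ r r<n → sym (reverse-!? X r<n)) (λ s s<m → sym (reverse-!? Y s<m))

    reversed : ∀ {a b c d} (p : Path a b c d) → InGrid c d →
               Rev.Path (length X ∸ c) (length Y ∸ d) (length X ∸ a) (length Y ∸ b)
    reversed p (c≤n , d≤m) = proj₁ (Fwd.reverse-path p c≤n d≤m)

    cost-reversed : ∀ {a b c d} (p : Path a b c d) (g : InGrid c d) → Rev.cost (reversed p g) ≡ cost p
    cost-reversed p (c≤n , d≤m) = proj₂ (Fwd.reverse-path p c≤n d≤m)

    through-reversed : ∀ {a b c d r s} (p : Path a b c d) (g : InGrid c d) →
                       Rev.Through (reversed p g) r s → Through p (length X ∸ r) (length Y ∸ s)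
    through-reversed {a} {b} {c} {d} p g@(c≤n , d≤m) (q₁ , q₂ , e) with start≤end p | Rev.start≤end q₂
    ... | a≤c , b≤d | r≤n∸a , s≤m∸b = back₂ , back₁ , (begin
      cost back₂ + cost back₁    ≡⟨ cong₂ _+_ (trans (Bwd.cost-cast a≡ b≡ refl refl _) (proj₂ rev₂))
                                              (trans (Bwd.cost-cast refl refl c≡ d≡ _) (proj₂ rev₁)) ⟩
      Rev.cost q₂ + Rev.cost q₁  ≡⟨ +-comm (Rev.cost q₂) (Rev.cost q₁) ⟩
      Rev.cost q₁ + Rev.cost q₂  ≡⟨ e ⟩
      Rev.cost (reversed p g)    ≡⟨ cost-reversed p g ⟩
      cost p                     ∎)
      where
        open ≡-Reasoning
        a≡ = m∸[m∸n]≡n (≤-trans a≤c c≤n)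
        b≡ = m∸[m∸n]≡n (≤-trans b≤d d≤m)
        c≡ = m∸[m∸n]≡n c≤n
        d≡ = m∸[m∸n]≡n d≤m
        rev₂ = Bwd.reverse-path q₂ (m∸n≤m (length X) a) (m∸n≤m (length Y) b)
        rev₁ = Bwd.reverse-path q₁ (≤-trans r≤n∸a (m∸n≤m (length X) a)) (≤-trans s≤m∸b (m∸n≤m (length Y) b))
        back₂ = Bwd.cast a≡ b≡ refl refl (proj₁ rev₂)
        back₁ = Bwd.cast refl refl c≡ d≡ (proj₁ rev₁)

    reversed-from : ∀ {a b c d a′} → length X ∸ c ≡ a′ → (p : Path a b c d) → InGrid c d →
                    Σ (Rev.Path a′ (length Y ∸ d) (length X ∸ a) (length Y ∸ b)) λ q →
                      Rev.cost q ≡ cost p × (∀ {r s} → Rev.Through q r s → Through p (length X ∸ r) (length Y ∸ s))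
    reversed-from refl p g = reversed p g , cost-reversed p g , through-reversed p g

  module Window (X Y : List A) where
    open Grid X Y

    dels : ∀ {a b c} → a ≤ c → Σ (Path a b c b) λ p → cost p ≡ c ∸ a
    dels {a} {b} {c} a≤c = go (c ∸ a) (sym (m∸n+n≡m a≤c))
      where
        go : ∀ k {a} → c ≡ k + a → Σ (Path a b c b) λ p → cost p ≡ k
        go zero    refl = [] , refl
        go (suc k) {a} e with go k (trans e (sym (+-suc k a)))
        ... | p , e′ = del p , cong suc e′

    -- Once p reaches column d, finish it with deletions instead.
    drop-last-column : ∀ {a b c d} (p : Path a b c (suc d)) → b ≤ d → Σ (Path a b c d) λ p′ → cost p′ ≤ suc (cost p)
    drop-last-column [] b≤d = ⊥-elim (<-irrefl refl b≤d)
    drop-last-column {a} {b} {c} {d} (diag p) b≤d with b ≟ℕ d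
    ... | no b≢d = let p′ , le = drop-last-column p (≤∧≢⇒< b≤d b≢d) in
      diag p′ , ≤-trans (+-monoʳ-≤ (matchCost (X !? a) (Y !? b)) le) (≤-reflexive (+-suc _ (cost p)))
    ... | yes refl with dels {b = b} (<⇒≤ (proj₁ (start≤end p)))
    ...   | q , e = q , (begin
      cost q                            ≡⟨ trans e (∸-suc (proj₁ (start≤end p))) ⟩
      suc (c ∸ suc a)                   ≤⟨ s≤s (rows≤cost p) ⟩
      suc (cost p)                      ≤⟨ s≤s (m≤n+m (cost p) _) ⟩
      suc (cost (diag p))               ∎)
      where open ≤-Reasoning
    drop-last-column (del p) b≤d = let p′ , le = drop-last-column p b≤d in del p′ , s≤s le
    drop-last-column {a} {b} {c} {d} (ins p) b≤d with b ≟ℕ d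
    ... | no b≢d = let p′ , le = drop-last-column p (≤∧≢⇒< b≤d b≢d) in ins p′ , s≤s le
    ... | yes refl with dels {b = b} (proj₁ (start≤end p))
    ...   | q , e = q , ≤-trans (≤-reflexive e)
                         (≤-trans (rows≤cost p) (≤-trans (n≤1+n _) (n≤1+n _)))

    drop-first-column : ∀ {a b c d} (p : Path a b c d) → b < d → Σ (Path a (suc b) c d) λ p′ → cost p′ ≤ suc (cost p)
    drop-first-column []             b<d = ⊥-elim (<-irrefl refl b<d)
    drop-first-column {a} {b} (diag p) _ = del p , s≤s (m≤n+m (cost p) (matchCost (X !? a) (Y !? b)))
    drop-first-column (del p)        b<d = let p′ , le = drop-first-column p b<d in del p′ , s≤s le
    drop-first-column (ins p)        _   = p , ≤-trans (n≤1+n _) (n≤1+n _)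

    module _ {a c} (a≤c : a ≤ c) (c≤n : c ≤ length X) where

      D-end-step : ∀ {b d} → b ≤ d → suc d ≤ length Y →
                   D a b c (suc d) ≤ suc (D a b c d) × D a b c d ≤ suc (D a b c (suc d))
      D-end-step {b} {d} b≤d d<m
        with optimal a≤c b≤d (c≤n , <⇒≤ d<m) | optimal a≤c (≤-trans b≤d (n≤1+n d)) (c≤n , d<m)
      ... | p , e | q , e′ with drop-last-column q b≤d
      ...   | q′ , le =
        ≤-trans (D≤cost (p ++ₚ ins []) (c≤n , d<m))
                (≤-reflexive (trans (cost-++ p (ins [])) (trans (+-comm (cost p) 1) (cong suc e)))) ,
        ≤-trans (D≤cost q′ (c≤n , <⇒≤ d<m)) (≤-trans le (s≤s (≤-reflexive e′)))

      D-start-step : ∀ {b d} → b < d → d ≤ length Y →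
                     D a (suc b) c d ≤ suc (D a b c d) × D a b c d ≤ suc (D a (suc b) c d)
      D-start-step {b} {d} b<d d≤m with optimal a≤c (<⇒≤ b<d) (c≤n , d≤m) | optimal a≤c b<d (c≤n , d≤m)
      ... | p , e | q , e′ with drop-first-column p b<d
      ...   | p′ , le =
        ≤-trans (D≤cost p′ (c≤n , d≤m)) (≤-trans le (s≤s (≤-reflexive e))) ,
        ≤-trans (D≤cost (ins q) (c≤n , d≤m)) (s≤s (≤-reflexive e′))

      D-move-end : ∀ {b d d′} → b ≤ d → b ≤ d′ → d ≤ length Y → d′ ≤ length Y → D a b c d′ ≤ D a b c d + ∣ d - d′ ∣
      D-move-end {b} b≤d b≤d′ d≤m d′≤m = Lipschitz.lipschitz (D a b c) (D-end-step {b}) b≤d d≤m b≤d′ d′≤m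

      D-move-start : ∀ {b b′ d} → b ≤ d → b′ ≤ d → d ≤ length Y → D a b′ c d ≤ D a b c d + ∣ b - b′ ∣
      D-move-start {d = d} b≤d b′≤d d≤m =
        Lipschitz.lipschitz (λ b → D a b c d) (λ _ b<d → D-start-step b<d d≤m) z≤n b≤d z≤n b′≤d

      D-move-columns : ∀ {b d b′ d′} → b ≤ d → b′ ≤ d′ → d ≤ length Y → d′ ≤ length Y →
                       D a b′ c d′ ≤ D a b c d + ∣ b - b′ ∣ + ∣ d - d′ ∣
      D-move-columns {b} {d} {b′} {d′} b≤d b′≤d′ d≤m d′≤m with b ≤? d′
      ... | yes b≤d′ = begin
        D a b′ c d′                          ≤⟨ D-move-start b≤d′ b′≤d′ d′≤m ⟩
        D a b c d′ + ∣ b - b′ ∣               ≤⟨ +-monoˡ-≤ _ (D-move-end b≤d b≤d′ d≤m d′≤m) ⟩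
        D a b c d + ∣ d - d′ ∣ + ∣ b - b′ ∣    ≡⟨ +-assoc (D a b c d) _ _ ⟩
        D a b c d + (∣ d - d′ ∣ + ∣ b - b′ ∣)  ≡⟨ cong (D a b c d +_) (+-comm ∣ d - d′ ∣ ∣ b - b′ ∣) ⟩
        D a b c d + (∣ b - b′ ∣ + ∣ d - d′ ∣)  ≡⟨ +-assoc (D a b c d) _ _ ⟨
        D a b c d + ∣ b - b′ ∣ + ∣ d - d′ ∣    ∎
        where open ≤-Reasoning
      ... | no b≰d′ = begin
        D a b′ c d′                          ≤⟨ D-move-end b′≤d b′≤d′ d≤m d′≤m ⟩
        D a b′ c d + ∣ d - d′ ∣               ≤⟨ +-monoˡ-≤ _ (D-move-start b≤d b′≤d d≤m) ⟩
        D a b c d + ∣ b - b′ ∣ + ∣ d - d′ ∣    ∎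
        where
          open ≤-Reasoning
          b′≤d : b′ ≤ d
          b′≤d = ≤-trans b′≤d′ (≤-trans (<⇒≤ (≰⇒> b≰d′)) b≤d)

    -- X′ = X(i .. j] and Y′ = Y(i .. j′] are cut out of an optimal alignment of X and Y, up to
    -- shifting the ends of Y′ by the offsets |i - si| and |sj - j′|, which the rest of the
    -- alignment pays for.
    window≤ : ∀ {i j} → i ≤ j → j ≤ length X → D i i j (j + length Y ∸ length X) ≤ D 0 0 (length X) (length Y)
    window≤ {i} {j} i≤j j≤n with optimal z≤n z≤n (≤-refl , ≤-refl) | i ≤? j + length Y ∸ length X
    ... | P , eP | yes i≤j′ with through-row P z≤n (≤-trans i≤j j≤n)
    ...   | si , (P₁ , P₂ , e₁) with through-row P₂ i≤j j≤n
    ...     | sj , (M , P₃ , e₂) = begin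
      D i i j j′                                    ≤⟨ D-move-columns i≤j j≤n (proj₂ (start≤end M)) i≤j′ sj≤m j′≤m ⟩
      D i si j sj + ∣ si - i ∣ + ∣ sj - j′ ∣          ≤⟨ +-mono-≤ (+-mono-≤ (D≤cost M (j≤n , sj≤m)) si-i≤) sj-j′≤ ⟩
      cost M + cost P₁ + cost P₃                    ≡⟨ rearrange (cost M) (cost P₁) (cost P₃) ⟩
      cost P₁ + (cost M + cost P₃)                  ≡⟨ trans (cong (cost P₁ +_) e₂) e₁ ⟩
      cost P                                        ≡⟨ eP ⟩
      D 0 0 n m                                     ∎
      where
        open ≤-Reasoning
        n = length X
        m = length Y
        rearrange : ∀ a b c → a + b + c ≡ b + (a + c)
        rearrange = solve-∀
        j′ = j + m ∸ n
        sj≤m = proj₂ (start≤end P₃)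
        j′≤m : j′ ≤ m
        j′≤m = m≤n+o⇒m∸n≤o (j + m) n (+-monoˡ-≤ m j≤n)
        si-i≤ : ∣ si - i ∣ ≤ cost P₁
        si-i≤ = subst (_≤ cost P₁) (∣-∣-comm i si) (∣rows-cols∣≤cost P₁)
        j′≡ : j′ ≡ sj + (m ∸ sj) ∸ (n ∸ j)
        j′≡ = trans (cong₂ (λ u v → j + u ∸ v) (sym (m+[n∸m]≡n sj≤m)) (sym (m+[n∸m]≡n j≤n)))
                    ([m+n]∸[m+o]≡n∸o j (sj + (m ∸ sj)) (n ∸ j))
        sj-j′≤ : ∣ sj - j′ ∣ ≤ cost P₃
        sj-j′≤ = subst (λ z → ∣ sj - z ∣ ≤ cost P₃) (sym j′≡)
                   (≤-trans (∣m-[m+n∸o]∣≤∣o-n∣ sj (m ∸ sj) (n ∸ j)) (∣rows-cols∣≤cost P₃))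
    window≤ {i} {j} i≤j j≤n | P , eP | no i≰j′ = begin
      D i i j (j + m ∸ n)           ≡⟨ cong (ed _≟_ (frag _≟_ X i j)) (frag-empty Y (<⇒≤ (≰⇒> i≰j′))) ⟩
      ed _≟_ (frag _≟_ X i j) []     ≡⟨ ed-[]ʳ (frag _≟_ X i j) ⟩
      length (frag _≟_ X i j)       ≡⟨ length-frag X i≤j j≤n ⟩
      j ∸ i                         ≤⟨ j-i≤n-m ⟩
      n ∸ m                         ≤⟨ m∸n≤∣m-n∣ n m ⟩
      ∣ n - m ∣                     ≤⟨ ∣rows-cols∣≤cost P ⟩
      cost P                        ≡⟨ eP ⟩
      D 0 0 n m                     ∎
      where
        open ≤-Reasoning
        n = length X
        m = length Y
        swap : ∀ a b c → a + b + c ≡ a + c + b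
        swap = solve-∀
        j-i≤n-m : j ∸ i ≤ n ∸ m
        j-i≤n-m = m+n≤o⇒m≤o∸n (j ∸ i) (+-cancelʳ-≤ i _ _ (begin
          j ∸ i + m + i      ≡⟨ trans (swap (j ∸ i) m i) (cong (_+ m) (m∸n+n≡m i≤j)) ⟩
          j + m              ≤⟨ m≤n+m∸n (j + m) n ⟩
          n + (j + m ∸ n)    ≤⟨ +-monoʳ-≤ n (<⇒≤ (≰⇒> i≰j′)) ⟩
          n + i              ∎))

  module Locality (X Y : List A) where
    open Grid X Y
    open Reversed X Y
    open Window X Y

    reverse-frag-spells : ∀ {lo x} → lo ≤ x → x ≤ length X → ∀ r → lo ≤ r → r < x →
                          reverse (frag _≟_ X lo x) !? (x ∸ suc r) ≡ X !? r
    reverse-frag-spells {lo} {x} lo≤x x≤n r lo≤r r<x = begin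
      reverse (frag _≟_ X lo x) !? (x ∸ suc r)                  ≡⟨ reverse-!? (frag _≟_ X lo x) x∸r-1<len ⟩
      frag _≟_ X lo x !? (length (frag _≟_ X lo x) ∸ suc (x ∸ suc r))
                                                                ≡⟨ cong (frag _≟_ X lo x !?_) index≡ ⟩
      frag _≟_ X lo x !? (r ∸ lo)                               ≡⟨ frag-!? X (∸-monoˡ-< r<x lo≤r) ⟩
      X !? (lo + (r ∸ lo))                                      ≡⟨ cong (X !?_) (m+[n∸m]≡n lo≤r) ⟩
      X !? r                                                    ∎
      where
        open ≡-Reasoning
        x∸r-1<len : x ∸ suc r < length (frag _≟_ X lo x)
        x∸r-1<len = subst (x ∸ suc r <_) (sym (length-frag X lo≤x x≤n)) (∸-monoʳ-< (s≤s lo≤r) r<x)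
        index≡ : length (frag _≟_ X lo x) ∸ suc (x ∸ suc r) ≡ r ∸ lo
        index≡ = trans (cong₂ _∸_ (length-frag X lo≤x x≤n) (sym (∸-suc r<x))) ([m∸n]∸[m∸o]≡o∸n lo≤r (<⇒≤ r<x))

    frag-spells-reverse : ∀ {x j} → x ≤ j → j < length X → ∀ r → length X ∸ suc j ≤ r → r < length X ∸ x →
                          frag _≟_ X x (suc j) !? ((length X ∸ x) ∸ suc r) ≡ reverse X !? r
    frag-spells-reverse {x} {j} x≤j j<n r n∸j-1≤r r<n∸x = begin
      frag _≟_ X x (suc j) !? t     ≡⟨ frag-!? X t<len ⟩
      X !? (x + t)                  ≡⟨ cong (X !?_) x+t≡ ⟩
      X !? (n ∸ suc r)              ≡⟨ reverse-!? X r<n ⟨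
      reverse X !? r                ∎
      where
        open ≡-Reasoning
        n = length X
        t = (n ∸ x) ∸ suc r
        r<n : r < n
        r<n = <-≤-trans r<n∸x (m∸n≤m n x)
        x+t≡ : x + t ≡ n ∸ suc r
        x+t≡ = trans (sym (+-∸-assoc x r<n∸x)) (cong (_∸ suc r) (m+[n∸m]≡n (≤-trans x≤j (<⇒≤ j<n))))
        n∸r-1≤j : n ∸ suc r ≤ j
        n∸r-1≤j = m≤n+o⇒m∸n≤o n (suc r) (≤-trans (m≤n+m∸n n (suc j))
                    (≤-trans (+-monoʳ-≤ (suc j) n∸j-1≤r) (≤-reflexive (cong suc (+-comm j r)))))
        t<len : t < suc j ∸ x
        t<len = m+n≤o⇒m≤o∸n (suc t) (s≤s (≤-trans (≤-reflexive (trans (+-comm t x) x+t≡)) n∸r-1≤j))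

    -- Since i = lo + 1 is minimal, reverse X(lo .. x] has more than B phrases.
    meet-left : ∀ {B lo x} → x ≤ length X → lo < x →
                (∀ i′ → i′ ≤ x → lzSize _≟_ (reverse (frag _≟_ X i′ x)) ≤ B → suc lo ≤ i′) →
                ∀ {u₀ uE v₀ vE} (U : Path (suc lo) u₀ x uE) (V : Path (suc lo) v₀ x vE) →
                2 + 2 * (cost U + cost V) + ∣ uE - vE ∣ ≤ B → Meet U V
    meet-left {B} {lo} {x} x≤n lo<x i-min U V budget
      with DA.meet-or-lz-bounded U V
      where
        module DA = DisjointAlignments X Y (reverse (frag _≟_ X lo x)) x lo
                      (trans (length-reverse (frag _≟_ X lo x)) (length-frag X (<⇒≤ lo<x) x≤n))
                      (reverse-frag-spells (<⇒≤ lo<x) x≤n)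
    ... | inj₁ m  = m
    ... | inj₂ lz = ⊥-elim (<-irrefl refl (i-min lo (<⇒≤ lo<x) (≤-trans lz budget)))

    module RightWalk {x j : ℕ} (x≤j : x ≤ j) (j<n : j < length X) =
      DisjointAlignments (reverse X) (reverse Y) (frag _≟_ X x (suc j)) (length X ∸ x) (length X ∸ suc j)
        (trans (length-frag X (≤-trans x≤j (n≤1+n j)) j<n) (sym ([m∸n]∸[m∸o]≡o∸n (≤-trans x≤j (n≤1+n j)) j<n)))
        (frag-spells-reverse x≤j j<n)

    -- The mirror image of meet-left, obtained by reading X and Y backwards.
    meet-right : ∀ {B x j} → x ≤ j → j < length X →
                 (∀ j′ → x ≤ j′ → j′ ≤ length X → lzSize _≟_ (frag _≟_ X x j′) ≤ B → j′ ≤ j) →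
                 ∀ {u₀ uE v₀ vE} (U : Path x u₀ j uE) (V : Path x v₀ j vE) → uE ≤ length Y → vE ≤ length Y →
                 2 + 2 * (cost U + cost V) + ∣ u₀ - v₀ ∣ ≤ B → Meet U V
    meet-right {B} {x} {j} x≤j j<n j-max {u₀} {uE} {v₀} {vE} U V uE≤m vE≤m budget
      with reversed-from (∸-suc j<n) U (<⇒≤ j<n , uE≤m) | reversed-from (∸-suc j<n) V (<⇒≤ j<n , vE≤m)
    ... | U′ , cost-U′ , through-U | V′ , cost-V′ , through-V with RightWalk.meet-or-lz-bounded x≤j j<n U′ V′
    ...   | inj₁ (r , s , t , t′) = length X ∸ r , length Y ∸ s , through-U t , through-V t′
    ...   | inj₂ lz = ⊥-elim (<-irrefl refl (j-max (suc j) (≤-trans x≤j (n≤1+n j)) j<n (≤-trans lz (begin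
      2 + 2 * (Rev.cost U′ + Rev.cost V′) + ∣ m ∸ u₀ - m ∸ v₀ ∣
        ≡⟨ cong₂ (λ c δ → 2 + 2 * c + δ) (cong₂ _+_ cost-U′ cost-V′) (∣m∸n-m∸o∣≡∣n-o∣ u₀≤m v₀≤m) ⟩
      2 + 2 * (cost U + cost V) + ∣ u₀ - v₀ ∣
        ≤⟨ budget ⟩
      B ∎))))
      where
        open ≤-Reasoning
        m = length Y
        u₀≤m = ≤-trans (proj₂ (start≤end U)) uE≤m
        v₀≤m = ≤-trans (proj₂ (start≤end V)) vE≤m

    prefixes-meet : ∀ k {x i} → x ≤ length X → i ≤ x →
                    (∀ i′ → i′ ≤ x → lzSize _≟_ (reverse (frag _≟_ X i′ x)) ≤ 6 * k + 2 → i ≤ i′) →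
                    ∀ {c₁ d₁ c₂ d₂} (W₁ : Path 0 0 c₁ d₁) (W₂ : Path i i c₂ d₂) → x ≤ c₁ → x ≤ c₂ →
                    cost W₁ ≤ k → cost W₂ ≤ k → Meet W₁ W₂
    prefixes-meet k {i = zero} _ _ _ W₁ W₂ _ _ _ _ = 0 , 0 , through-start W₁ , through-start W₂
    prefixes-meet k {x} {suc lo} x≤n i≤x i-min W₁ W₂ x≤c₁ x≤c₂ W₁≤k W₂≤k
      with through-row W₁ z≤n (≤-trans i≤x x≤c₁) | through-row W₂ i≤x x≤c₂
    ... | si , t₁@(P₁ , P₂ , e₁) | q₀ , t₂@(Q₁ , Q₂ , e₂) with through-row P₂ i≤x x≤c₁
    ...   | p₀ , t₃@(M , _ , e₃)
      with meet-left x≤n i≤x i-min M Q₁ (budget≤6k+2 {u = cost M} {cost Q₁} {cost P₁} {0} M+P₁≤k Q₁+0≤k offsets)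
      where
        M+P₁≤k : cost M + cost P₁ ≤ k
        M+P₁≤k = ≤-trans (≤-reflexive (+-comm (cost M) (cost P₁)))
                   (≤-trans (+-monoʳ-≤ (cost P₁) (≤-trans (m≤m+n (cost M) _) (≤-reflexive e₃)))
                     (≤-trans (≤-reflexive e₁) W₁≤k))
        Q₁+0≤k : cost Q₁ + 0 ≤ k
        Q₁+0≤k = ≤-trans (≤-reflexive (+-identityʳ (cost Q₁)))
                   (≤-trans (m≤m+n (cost Q₁) _) (≤-trans (≤-reflexive e₂) W₂≤k))
        offsets : ∣ p₀ - q₀ ∣ ≤ (cost M + cost P₁) + (cost Q₁ + 0)
        offsets = ≤-trans (∣-∣-triangle p₀ x q₀) (+-mono-≤
          (subst₂ _≤_ (∣-∣-comm x p₀) (trans (cost-++ P₁ M) (+-comm (cost P₁) (cost M)))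
                      (∣rows-cols∣≤cost (P₁ ++ₚ M)))
          (subst₂ _≤_ (∣m∸o-n∸o∣≡∣m-n∣ i≤x (proj₂ (start≤end Q₁))) (sym (+-identityʳ (cost Q₁)))
                      (∣rows-cols∣≤cost Q₁)))
    ...     | r , s , tM , tQ₁ =
      r , s , through-second {p = W₁} t₁ (through-first {p = P₂} t₃ tM) , through-first {p = W₂} t₂ tQ₁

    suffixes-meet : ∀ k {x i j} → i ≤ x → x ≤ j → j ≤ length X →
                    (∀ j′ → x ≤ j′ → j′ ≤ length X → lzSize _≟_ (frag _≟_ X x j′) ≤ 6 * k + 2 → j′ ≤ j) →
                    ∀ {a₁ b₁ a₂ b₂} (Z₁ : Path 0 0 a₁ b₁) (W₁ : Path a₁ b₁ (length X) (length Y))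
                      (Z₂ : Path i i a₂ b₂) (W₂ : Path a₂ b₂ j (j + length Y ∸ length X)) →
                    a₁ ≤ x → a₂ ≤ x → cost Z₁ + cost W₁ ≤ k → cost Z₂ + cost W₂ ≤ k → Meet W₁ W₂
    suffixes-meet k {x} {i} {j} i≤x x≤j j≤n j-max Z₁ W₁ Z₂ W₂ a₁≤x a₂≤x Z₁W₁≤k Z₂W₂≤k with j ≟ℕ length X
    ... | yes refl = length X , length Y , through-end W₁ ,
                     subst (Through W₂ (length X)) (m+n∸m≡n (length X) (length Y)) (through-end W₂)
    ... | no j≢n with through-row W₁ a₁≤x (≤-trans x≤j j≤n) | through-row W₂ a₂≤x x≤j
    ...   | p₀ , t₁@(P₁ , P₂ , e₁) | q₀ , t₂@(Q₁ , Q₂ , e₂) with through-row P₂ x≤j j≤n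
    ...     | _ , t₃@(M , M′ , e₃)
      with meet-right x≤j (≤∧≢⇒< j≤n j≢n) j-max M Q₂ (proj₂ (start≤end M′)) j′≤m
             (budget≤6k+2 {u = cost M} {cost Q₂} {cost Z₁ + cost P₁} {cost Z₂ + cost Q₁} M+Z₁P₁≤k Q₂+Z₂Q₁≤k offsets)
      where
        j′≤m : j + length Y ∸ length X ≤ length Y
        j′≤m = m≤n+o⇒m∸n≤o (j + length Y) (length X) (+-monoˡ-≤ (length Y) j≤n)
        rotate : ∀ a b c → a + (b + c) ≡ b + (c + a)
        rotate = solve-∀
        M+Z₁P₁≤k : cost M + (cost Z₁ + cost P₁) ≤ k
        M+Z₁P₁≤k = ≤-trans (≤-reflexive (rotate (cost M) (cost Z₁) (cost P₁)))
                     (≤-trans (+-monoʳ-≤ (cost Z₁) (+-monoʳ-≤ (cost P₁)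
                                 (≤-trans (m≤m+n (cost M) (cost M′)) (≤-reflexive e₃))))
                       (≤-trans (≤-reflexive (cong (cost Z₁ +_) e₁)) Z₁W₁≤k))
        Q₂+Z₂Q₁≤k : cost Q₂ + (cost Z₂ + cost Q₁) ≤ k
        Q₂+Z₂Q₁≤k = ≤-trans (≤-reflexive (trans (rotate (cost Q₂) (cost Z₂) (cost Q₁)) (cong (cost Z₂ +_) e₂))) Z₂W₂≤k
        offsets : ∣ p₀ - q₀ ∣ ≤ (cost M + (cost Z₁ + cost P₁)) + (cost Q₂ + (cost Z₂ + cost Q₁))
        offsets = ≤-trans (∣-∣-triangle p₀ x q₀) (+-mono-≤
          (≤-trans (subst₂ _≤_ (∣-∣-comm x p₀) (cost-++ Z₁ P₁) (∣rows-cols∣≤cost (Z₁ ++ₚ P₁))) (m≤n+m _ (cost M)))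
          (≤-trans (subst₂ _≤_ (∣m∸o-n∸o∣≡∣m-n∣ i≤x (proj₂ (start≤end (Z₂ ++ₚ Q₁)))) (cost-++ Z₂ Q₁)
                     (∣rows-cols∣≤cost (Z₂ ++ₚ Q₁))) (m≤n+m _ (cost Q₂))))
    ...       | r , s , tM , tQ₂ = r , s , through-second {p = W₁} t₁ (through-first {p = P₂} t₃ tM) ,
                                  through-second {p = W₂} t₂ tQ₂

  module Anchors (X Y : List A) where
    open Grid X Y
    open Window X Y
    open Locality X Y

    -- If i = lo + 1 > 0 then X(lo .. x] has more than 6k + 2 ≥ k + 1 letters, and |X| ≤ |Y| + k.
    window-nonempty : ∀ k {x i j} → i ≤ x → x ≤ j → x ≤ length X →
                      (∀ i′ → i′ ≤ x → lzSize _≟_ (reverse (frag _≟_ X i′ x)) ≤ 6 * k + 2 → i ≤ i′) →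
                      D 0 0 (length X) (length Y) ≤ k → i ≤ j + length Y ∸ length X
    window-nonempty k {i = zero} _ _ _ _ _ = z≤n
    window-nonempty k {x} {suc lo} {j} i≤x x≤j x≤n i-min D≤k with lzSize _≟_ (reverse (frag _≟_ X lo x)) ≤? 6 * k + 2
    ... | yes lz≤ = ⊥-elim (<-irrefl refl (i-min lo (<⇒≤ i≤x) lz≤))
    ... | no lz≰ = m+n≤o⇒m≤o∸n (suc lo) (begin
      suc lo + n           ≤⟨ +-monoʳ-≤ (suc lo) n≤m+k ⟩
      suc lo + (m + k)     ≡⟨ rotate (suc lo) m k ⟩
      suc lo + k + m       ≤⟨ +-monoˡ-≤ m (≤-trans lo+k<x x≤j) ⟩
      j + m                ∎)
      where
        open ≤-Reasoning
        n = length X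
        m = length Y
        rotate : ∀ a b c → a + (b + c) ≡ a + c + b
        rotate = solve-∀
        n≤m+k : n ≤ m + k
        n≤m+k with optimal {0} {0} z≤n z≤n (≤-refl , ≤-refl)
        ... | P , eP = ≤-trans (m≤n+m∸n n m) (+-monoʳ-≤ m (≤-trans (m∸n≤∣m-n∣ n m)
                         (≤-trans (∣rows-cols∣≤cost P) (≤-trans (≤-reflexive eP) D≤k))))
        6k+2<x-lo : 6 * k + 2 < x ∸ lo
        6k+2<x-lo = <-≤-trans (≰⇒> lz≰) (≤-trans (Parsing.lzSize≤length (reverse (frag _≟_ X lo x)))
                      (≤-reflexive (trans (length-reverse (frag _≟_ X lo x)) (length-frag X (<⇒≤ i≤x) x≤n))))
        lo+k<x : suc lo + k ≤ x
        lo+k<x = ≤-trans (≤-by (5 * k + 2) (spread lo k))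
                   (≤-trans (+-monoʳ-≤ lo 6k+2<x-lo) (≤-reflexive (m+[n∸m]≡n (<⇒≤ i≤x))))
          where spread : ∀ lo k → lo + suc (6 * k + 2) ≡ suc lo + k + (5 * k + 2)
                spread = solve-∀

    module Localised (k : ℕ) {x y i j : ℕ} (x≤n : x ≤ length X) (y≤m : y ≤ length Y)
             (i≤x : i ≤ x) (x≤j : x ≤ j) (j≤n : j ≤ length X)
             (i-min : ∀ i′ → i′ ≤ x → lzSize _≟_ (reverse (frag _≟_ X i′ x)) ≤ 6 * k + 2 → i ≤ i′)
             (j-max : ∀ j′ → x ≤ j′ → j′ ≤ length X → lzSize _≟_ (frag _≟_ X x j′) ≤ 6 * k + 2 → j′ ≤ j)
             (D≤k : D 0 0 (length X) (length Y) ≤ k) where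

      private
        n = length X
        m = length Y
        j′ = j + m ∸ n
        j′≤m : j′ ≤ m
        j′≤m = m≤n+o⇒m∸n≤o (j + m) n (+-monoˡ-≤ m j≤n)
        window≤k : D i i j j′ ≤ k
        window≤k = ≤-trans (window≤ (≤-trans i≤x x≤j) j≤n) D≤k

      full⇒window : D 0 0 n m ≡ D 0 0 x y + D x y n m → EditAnchorFrag _≟_ X Y i j i j′ x y
      full⇒window anchor
        with optimal z≤n z≤n (x≤n , y≤m) | optimal x≤n y≤m (≤-refl , ≤-refl)
           | optimal (≤-trans i≤x x≤j) (window-nonempty k i≤x x≤j x≤n i-min D≤k) (j≤n , j′≤m)
      ... | P₁ , e₁ | P₂ , e₂ | Q , eQ
        with prefixes-meet k x≤n i≤x i-min P₁ Q ≤-refl x≤j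
               (≤-trans (≤-reflexive e₁) (≤-trans (m≤m+n _ _) (≤-trans (≤-reflexive (sym anchor)) D≤k)))
               (≤-trans (≤-reflexive eQ) window≤k)
      ... | r , s , (P₁₁ , P₁₂ , e₁₁) , (Q₁ , Q₂ , eQ₁)
        with suffixes-meet k i≤x x≤j j≤n j-max P₁ P₂ Q₁ Q₂ ≤-refl (proj₁ (start≤end P₁₂))
               (≤-trans (≤-reflexive (trans (cong₂ _+_ e₁ e₂) (sym anchor))) D≤k)
               (≤-trans (≤-reflexive (trans eQ₁ eQ)) window≤k)
      ... | r₂ , s₂ , (P₂₁ , P₂₂ , e₂₁) , (Q₂₁ , Q₂₂ , eQ₂) =
        i≤x , x≤j , ≤-trans (proj₂ (start≤end Q₁)) (proj₂ (start≤end P₁₂)) ,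
        ≤-trans (proj₂ (start≤end P₂₁)) (proj₂ (start≤end Q₂₂)) ,
        anchor-splice (≤-refl , ≤-refl) (j≤n , j′≤m) P₁₁ P₁₂ P₂₁ P₂₂
          (trans (cong₂ _+_ e₁₁ e₂₁) (trans (cong₂ _+_ e₁ e₂) (sym anchor)))
          Q₁ Q₂₁ Q₂₂ (trans (cong (cost Q₁ +_) eQ₂) (trans eQ₁ eQ))

      window⇒full : EditAnchorFrag _≟_ X Y i j i j′ x y → D 0 0 n m ≡ D 0 0 x y + D x y n m
      window⇒full (_ , _ , i≤y , y≤j′ , anchor)
        with optimal z≤n z≤n (≤-refl , ≤-refl) | optimal i≤x i≤y (x≤n , y≤m) | optimal x≤j y≤j′ (j≤n , j′≤m)
      ... | P , eP | Q₁ , eQ₁ | Q₂ , eQ₂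
        with prefixes-meet k x≤n i≤x i-min P Q₁ x≤n ≤-refl (≤-trans (≤-reflexive eP) D≤k)
               (≤-trans (≤-reflexive eQ₁) (≤-trans (m≤m+n _ _) (≤-trans (≤-reflexive (sym anchor)) window≤k)))
      ... | r , s , (P₁ , P₂ , eP₁) , (Q₁₁ , Q₁₂ , eQ₁₁)
        with suffixes-meet k i≤x x≤j j≤n j-max P₁ P₂ Q₁ Q₂ (proj₁ (start≤end Q₁₂)) ≤-refl
               (≤-trans (≤-reflexive (trans eP₁ eP)) D≤k)
               (≤-trans (≤-reflexive (trans (cong₂ _+_ eQ₁ eQ₂) (sym anchor))) window≤k)
      ... | r₂ , s₂ , (P₂₁ , P₂₂ , eP₂) , (Q₂₁ , Q₂₂ , eQ₂₁) =
        anchor-splice (j≤n , j′≤m) (≤-refl , ≤-refl) Q₁₁ Q₁₂ Q₂₁ Q₂₂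
          (trans (cong₂ _+_ eQ₁₁ eQ₂₁) (trans (cong₂ _+_ eQ₁ eQ₂) (sym anchor)))
          P₁ P₂₁ P₂₂ (trans (cong (cost P₁ +_) eP₂) (trans eP₁ eP))

lemma4p6 : {A : Set} (_≟_ : DecidableEquality A) (X Y : List A) (k x y i j : ℕ) →
  x ≤ length X → y ≤ length Y →
  -- i is the minimum i ∈ [0..x] with |LZ(reverse of X(i..x])| ≤ 6k+2
  i ≤ x → lzSize _≟_ (reverse (frag _≟_ X i x)) ≤ 6 * k + 2 →
  ((i' : ℕ) → i' ≤ x → lzSize _≟_ (reverse (frag _≟_ X i' x)) ≤ 6 * k + 2 → i ≤ i') →
  -- j is the maximum j ∈ [x..|X|] with |LZ(X(x..j])| ≤ 6k+2
  x ≤ j → j ≤ length X → lzSize _≟_ (frag _≟_ X x j) ≤ 6 * k + 2 →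
  ((j' : ℕ) → x ≤ j' → j' ≤ length X → lzSize _≟_ (frag _≟_ X x j') ≤ 6 * k + 2 → j' ≤ j) →
  ed _≟_ X Y ≤ k →
  EditAnchor _≟_ X Y x y ⇔ EditAnchorFrag _≟_ X Y i j i (j + length Y ∸ length X) x y
lemma4p6 _≟_ X Y k x y i j x≤n y≤m i≤x _ i-min x≤j j≤n _ j-max ed≤k =
  mk⇔ (λ (_ , _ , _ , _ , anchor) → full⇒window anchor)
      (λ anchor → z≤n , x≤n , z≤n , y≤m , window⇒full anchor)
  where
    open EditAnchors _≟_
    open Grid X Y using (D-whole)
    open Anchors X Y
    open Localised k x≤n y≤m i≤x x≤j j≤n i-min j-max (≤-trans (≤-reflexive D-whole) ed≤k)
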